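{- Let $G$ be a graph with $n$ vertices, $m$ edges and $k(G)$ connected components. Then for every integer $i>n-k(G)-h(G)$, \[ [x^i]\,T_G(x,1)=\binom{m-i-1}{n-k(G)-i}-\sum_{\substack{C\in\mathcal{C}(G)\\ |C|<h(G)}}\binom{m-|C|-i-1}{m-n+k(G)-1}. \]
   Context: $T_G(x,y)$ is the Tutte polynomial of $G$, i.e. $T_G(x,y)=\sum_{A\subseteq E}(x-1)^{rk(E)-rk(A)}(y-1)^{|A|-rk(A)}$ with $rk(A)=|V|-k(A)$, where $k(A)$ is the number of components of the spanning subgraph $(V,A)$; $[x^i]f(x)$ denotes the coefficient of $x^i$. $\mathcal{C}(G)$ is the set of cycles of $G$ (viewed as edge sets), and $|C|$ is the number of edges of $C$. The corank of a subgraph $H$ is $|E(H)|-|V(H)|+k(H)$. $h(G)$ is the minimum number of edges of a subgraph of $G$ of corank $2$ containing no cut edges (equivalently, the minimum $|A|$ over edge sets $A\subseteq E$ with $rk(A\setminus\{e\})=rk(A)$ for all $e\in A$ and $rk(A)=|A|-2$). -}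

module Defs where

import Data.Bool.ListAction as BLA
open import Data.Bool using (Bool; true; false; _∧_; _∨_; not; if_then_else_)
open import Data.Nat as ℕ using (ℕ; zero; suc)
import Data.Nat.Combinatorics as Comb
open import Data.Integer as ℤ using (ℤ; +_; -[1+_])
open import Data.Fin as Fin using (Fin)
open import Data.Fin.Subset using (Subset; inside; outside; ∣_∣)
open import Data.Vec as Vec using (Vec; []; _∷_)
open import Data.List as List using (List; []; _∷_)
open import Data.Product using (_×_; _,_; proj₁; proj₂; Σ)
open import Relation.Binary.PropositionalEquality using (_≡_)
open import Relation.Nullary.Decidable using (⌊_⌋)

-- Finite multigraphs (loops and parallel edges allowed):
-- vertex set Fin n, edge set Fin m, each edge has two endpoints.

record Graph (n m : ℕ) : Set where
  field
    ends : Fin m → Fin n × Fin n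
open Graph public

allSubsets : (m : ℕ) → List (Subset m)
allSubsets zero    = [] ∷ []
allSubsets (suc m) =
  List.map (outside ∷_) (allSubsets m) List.++ List.map (inside ∷_) (allSubsets m)

_∈ᵇ_ : ∀ {m} → Fin m → Subset m → Bool
e ∈ᵇ A = Vec.lookup A e

_==_ : ∀ {n} → Fin n → Fin n → Bool
u == v = ⌊ u Fin.≟ v ⌋

anyFin : ∀ {k} → (Fin k → Bool) → Bool
anyFin {k} p = BLA.any p (List.allFin k)

allFin : ∀ {k} → (Fin k → Bool) → Bool
allFin {k} p = BLA.all p (List.allFin k)

countFin : ∀ {k} → (Fin k → Bool) → ℕ
countFin {k} p = List.length (List.filter (λ x → Relation.Nullary.Decidable.Core.T? (p x)) (List.allFin k))
  where import Relation.Nullary.Decidable.Core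

reach : ∀ {n m} → Graph n m → Subset m → ℕ → Fin n → Fin n → Bool
reach G A zero    u v = u == v
reach G A (suc s) u v =
  reach G A s u v ∨
  anyFin (λ e → e ∈ᵇ A ∧
    ((reach G A s u (proj₁ (ends G e)) ∧ (proj₂ (ends G e) == v)) ∨
     (reach G A s u (proj₂ (ends G e)) ∧ (proj₁ (ends G e) == v))))

-- u and v lie in the same component of the spanning subgraph (V, A)
-- (walks of length ≤ n suffice)
connected : ∀ {n m} → Graph n m → Subset m → Fin n → Fin n → Bool
connected {n} G A u v = reach G A n u v

-- k(A): number of components of (V, A) = number of vertices that are
-- the least vertex of their component
ncomp : ∀ {n m} → Graph n m → Subset m → ℕ
ncomp G A = countFin (λ v → not (anyFin (λ u → ⌊ Fin.toℕ u ℕ.<? Fin.toℕ v ⌋ ∧ connected G A u v)))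

rk : ∀ {n m} → Graph n m → Subset m → ℕ
rk {n} G A = n ℕ.∸ ncomp G A

fullSet : ∀ {m} → Subset m
fullSet = Data.Fin.Subset.⊤

kG : ∀ {n m} → Graph n m → ℕ
kG G = ncomp G fullSet

module PolyOps {C : Set} (0# : C) (_+_ _*_ : C → C → C) where
  addP : List C → List C → List C
  addP []       q        = q
  addP (a ∷ p)  []       = a ∷ p
  addP (a ∷ p)  (b ∷ q)  = (a + b) ∷ addP p q

  scaleP : C → List C → List C
  scaleP c = List.map (c *_)

  mulP : List C → List C → List C
  mulP []      q = []
  mulP (a ∷ p) q = addP (scaleP a q) (0# ∷ mulP p q)

  powP : List C → List C → ℕ → List C   -- second argument: the unit polynomial
  powP p one zero    = one
  powP p one (suc k) = mulP p (powP p one k)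

-- ℤ[y] : list of integer coefficients (index = power of y)
PolyY : Set
PolyY = List ℤ

module PY = PolyOps (+ 0) ℤ._+_ ℤ._*_

-- ℤ[y][x] = ℤ[x,y] : list (index = power of x) of polynomials in y
Poly2 : Set
Poly2 = List PolyY

module P2 = PolyOps [] PY.addP PY.mulP

one2 : Poly2
one2 = ((+ 1) ∷ []) ∷ []

xMinus1 : Poly2
xMinus1 = (ℤ.- (+ 1) ∷ []) ∷ ((+ 1) ∷ []) ∷ []

yMinus1 : Poly2
yMinus1 = (ℤ.- (+ 1) ∷ (+ 1) ∷ []) ∷ []

tutte : ∀ {n m} → Graph n m → Poly2
tutte {n} {m} G =
  List.foldr P2.addP []
    (List.map (λ A → P2.mulP (P2.powP xMinus1 one2 (rk G fullSet ℕ.∸ rk G A))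
                              (P2.powP yMinus1 one2 (∣ A ∣ ℕ.∸ rk G A)))
              (allSubsets m))

evalY1 : Poly2 → List ℤ
evalY1 = List.map (List.foldr ℤ._+_ (+ 0))

tutteX1 : ∀ {n m} → Graph n m → List ℤ
tutteX1 G = evalY1 (tutte G)

-- [x^i] f  for an integer i (zero for negative i or i beyond the list)
coeff : List ℤ → ℤ → ℤ
coeff p (+ i)    = Data.Maybe.fromMaybe (+ 0) (List.head (List.drop i p))
  where import Data.Maybe
coeff p -[1+ i ] = + 0

-- Binomial coefficient on integers: C(a,b) = 0 if a < 0 or b < 0,
-- otherwise the usual (which is 0 when b > a).
binomℤ : ℤ → ℤ → ℤ
binomℤ (+ a) (+ b) = + (a Comb.C b)
binomℤ _     _     = + 0

-- Cycles: nonempty edge sets C such that every vertex has degree 0 or 2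
-- in C (a loop contributes 2) and the edges of C form a connected subgraph.

deg : ∀ {n m} → Graph n m → Subset m → Fin n → ℕ
deg G A v =
  countFin (λ e → e ∈ᵇ A ∧ (proj₁ (ends G e) == v)) ℕ.+
  countFin (λ e → e ∈ᵇ A ∧ (proj₂ (ends G e) == v))

isCycle : ∀ {n m} → Graph n m → Subset m → Bool
isCycle G C =
  anyFin (λ e → e ∈ᵇ C) ∧
  allFin (λ v → ⌊ deg G C v ℕ.≟ 0 ⌋ ∨ ⌊ deg G C v ℕ.≟ 2 ⌋) ∧
  allFin (λ e → allFin (λ f →
    not (e ∈ᵇ C ∧ f ∈ᵇ C) ∨ connected G C (proj₁ (ends G e)) (proj₁ (ends G f))))

cycles : ∀ {n m} → Graph n m → List (Subset m)
cycles {n} {m} G = List.filter (λ C → Relation.Nullary.Decidable.Core.T? (isCycle G C)) (allSubsets m)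
  where import Relation.Nullary.Decidable.Core

remove : ∀ {m} → Subset m → Fin m → Subset m
remove A e = A Vec.[ e ]≔ outside

-- A has no cut edges (rk(A \ {e}) = rk(A) for all e ∈ A) and rk(A) = |A| - 2
-- (i.e. corank 2; note rk(A) ≤ |A| always so we state |A| = rk(A) + 2)
BridgelessCorank2 : ∀ {n m} → Graph n m → Subset m → Set
BridgelessCorank2 {n} {m} G A =
  ((e : Fin m) → e ∈ᵇ A ≡ true → rk G (remove A e) ≡ rk G A) ×
  (∣ A ∣ ≡ rk G A ℕ.+ 2)

IsH : ∀ {n m} → Graph n m → ℕ → Set
IsH {n} {m} G h =
  (Σ (Subset m) λ A → BridgelessCorank2 G A × ∣ A ∣ ≡ h) ×
  ((A : Subset m) → BridgelessCorank2 G A → h ℕ.≤ ∣ A ∣)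

sumℤ : List ℤ → ℤ
sumℤ = List.foldr ℤ._+_ (+ 0)

module Submission where

-- With r = n - k(G), T_G(x,1) = Σ_A (x-1)^(r - rk A) 0^(corank A), so only forests A contribute,
-- each with w(|A|), where w(j) = [x^i] (x-1)^(r-j) = (-i-1 choose r-i-j). For i > r - h the weight
-- vanishes once |A| ≥ h, and an edge set with |A| < h has corank at most 1 (otherwise it would
-- contain a bridgeless subset of corank 2, of size at least h). It is therefore a forest exactly
-- when it contains none of the cycles, and otherwise it contains exactly one, so
--   [x^i] T_G(x,1) = Σ_A w(|A|) - Σ_{C, |C| < h} Σ_{A ⊇ C} w(|A|).
-- Each sum Σ_j (M choose j) w(c + j) is (M - i - 1 choose r - c - i) by Pascal's rule for binomial
-- coefficients with an integer top, and symmetry turns the cycle terms into the stated form.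

open import Defs
open import Data.Nat using (ℕ; zero; suc; z≤n; s≤s)
import Data.Nat as ℕ
import Data.Nat.Properties as ℕ
import Data.Nat.Combinatorics as ℕ
open import Data.Nat.Combinatorics using (nCk+nC[k+1]≡[n+1]C[k+1]; k>n⇒nCk≡0; nCk≡nC[n∸k])
open import Data.Bool using (Bool; true; false; _∧_; _∨_; not; if_then_else_; T)
import Data.Bool.Properties as Bool
open import Data.Fin as Fin using (Fin; zero; suc; toℕ)
import Data.Fin.Properties as Fin
open import Data.Fin.Subset using (Subset; inside; outside; ∣_∣)
open import Data.Fin.Subset.Properties using (p⊆q⇒∣p∣≤∣q∣; ∣p∣≤n; ∣⊤∣≡n)
open import Data.Vec using ([]; _∷_)
import Data.Vec.Properties as Vec
open import Data.List as List using (List; []; _∷_; map; foldr; filter; _++_; tabulate; length)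
import Data.Bool.ListAction as BLA
open import Data.List.Properties using (map-cong)
import Data.List.Relation.Unary.Any as Any
import Data.List.Relation.Unary.All as All
open import Data.List.Relation.Unary.Any.Properties using (any⁺; any⁻)
open import Data.List.Relation.Unary.All.Properties using (all⁺; all⁻; tabulate⁺)
open import Data.List.Membership.Propositional.Properties using (∈-allFin)
open import Algebra.Properties.CommutativeMonoid.Sum ℕ.+-0-commutativeMonoid
  using (sum; sum-syntax; sum-cong-≗; ∑-distrib-+; ∑-comm)
open import Algebra.Properties.Semiring.Sum ℕ.+-*-semiring using (*-distribˡ-sum)
open import Data.Product using (∃; _,_; proj₁; proj₂; _×_)
open import Data.Sum using (_⊎_; inj₁; inj₂)
open import Data.Empty using (⊥; ⊥-elim)
open import Function using (_∘_; Equivalence)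
open import Level using (0ℓ)
open import Relation.Nullary using (¬_; Dec; yes; no; does; ¬?; _×-dec_)
open import Relation.Nullary.Decidable using (⌊_⌋; dec-true)
import Relation.Nullary.Decidable.Core as Dec
open import Relation.Unary using (Pred; Decidable)
open import Relation.Binary using (tri<; tri≈; tri>)
open import Relation.Binary.PropositionalEquality

module FinCounting where

  open import Data.Nat using (_+_; _*_; _≤_)

  ∨-introˡ : ∀ {a b} → a ≡ true → a ∨ b ≡ true
  ∨-introˡ refl = refl

  ∨-introʳ : ∀ a {b} → b ≡ true → a ∨ b ≡ true
  ∨-introʳ false b≡true = b≡true
  ∨-introʳ true  _      = refl

  ∨-elim : ∀ a {b} → a ∨ b ≡ true → a ≡ true ⊎ b ≡ true
  ∨-elim true  _ = inj₁ refl
  ∨-elim false p = inj₂ p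

  ∧-intro : ∀ {a b} → a ≡ true → b ≡ true → a ∧ b ≡ true
  ∧-intro refl refl = refl

  ∧-elimˡ : ∀ a {b} → a ∧ b ≡ true → a ≡ true
  ∧-elimˡ true _ = refl

  ∧-elimʳ : ∀ a {b} → a ∧ b ≡ true → b ≡ true
  ∧-elimʳ true p = p

  not-true : ∀ {a} → not a ≡ true → a ≡ false
  not-true {false} _ = refl

  true≢false : ∀ {a} → a ≡ true → a ≡ false → ⊥
  true≢false refl ()

  ≡true⊎≡false : ∀ b → b ≡ true ⊎ b ≡ false
  ≡true⊎≡false true  = inj₁ refl
  ≡true⊎≡false false = inj₂ refl

  bool-ext : ∀ {a b} → (a ≡ true → b ≡ true) → (b ≡ true → a ≡ true) → a ≡ b
  bool-ext {true}  {true}  _ _ = refl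
  bool-ext {true}  {false} f _ = sym (f refl)
  bool-ext {false} {true}  _ g = g refl
  bool-ext {false} {false} _ _ = refl

  ⌊⌋⇒ : ∀ {A : Set} (a? : Dec A) → ⌊ a? ⌋ ≡ true → A
  ⌊⌋⇒ (yes a) _ = a

  ⌊⌋-true : ∀ {A : Set} (a? : Dec A) → A → ⌊ a? ⌋ ≡ true
  ⌊⌋-true (yes _) _ = refl
  ⌊⌋-true (no ¬a) a = ⊥-elim (¬a a)

  ⌊⌋-false : ∀ {A : Set} (a? : Dec A) → ¬ A → ⌊ a? ⌋ ≡ false
  ⌊⌋-false (yes a) ¬a = ⊥-elim (¬a a)
  ⌊⌋-false (no _)  _  = refl

  ≡⇒T : ∀ {b} → b ≡ true → T b
  ≡⇒T = Equivalence.from Bool.T-≡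

  T⇒≡ : ∀ {b} → T b → b ≡ true
  T⇒≡ = Equivalence.to Bool.T-≡

  ==⇒≡ : ∀ {k} {u v : Fin k} → (u == v) ≡ true → u ≡ v
  ==⇒≡ {u = u} {v} = ⌊⌋⇒ (u Fin.≟ v)

  ≡⇒== : ∀ {k} {u v : Fin k} → u ≡ v → (u == v) ≡ true
  ≡⇒== {u = u} {v} = ⌊⌋-true (u Fin.≟ v)

  ≢⇒== : ∀ {k} {u v : Fin k} → u ≢ v → (u == v) ≡ false
  ≢⇒== {u = u} {v} = ⌊⌋-false (u Fin.≟ v)

  ==-refl : ∀ {k} (u : Fin k) → (u == u) ≡ true
  ==-refl u = ≡⇒== refl

  anyFin-intro : ∀ {k} (p : Fin k → Bool) x → p x ≡ true → anyFin p ≡ true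
  anyFin-intro p x px = T⇒≡ (any⁺ p (Any.map (λ x≡y → subst (T ∘ p) x≡y (≡⇒T px)) (∈-allFin x)))

  anyFin-elim : ∀ {k} (p : Fin k → Bool) → anyFin p ≡ true → ∃ λ x → p x ≡ true
  anyFin-elim {k} p any≡true with Any.satisfied (any⁻ p (List.allFin k) (≡⇒T any≡true))
  ... | x , px = x , T⇒≡ px

  anyFin-false : ∀ {k} (p : Fin k → Bool) → ¬ (∃ λ x → p x ≡ true) → anyFin p ≡ false
  anyFin-false p none with anyFin p in any≡
  ... | false = refl
  ... | true  = ⊥-elim (none (anyFin-elim p any≡))

  anyFin-cong : ∀ {k} {p q : Fin k → Bool} → (∀ x → p x ≡ q x) → anyFin p ≡ anyFin q
  anyFin-cong {k} p≗q = cong BLA.or (map-cong p≗q (List.allFin k))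

  allFin-intro : ∀ {k} (p : Fin k → Bool) → (∀ x → p x ≡ true) → allFin p ≡ true
  allFin-intro p all≡true = T⇒≡ (all⁻ p (tabulate⁺ (λ x → ≡⇒T (all≡true x))))

  allFin-elim : ∀ {k} (p : Fin k → Bool) → allFin p ≡ true → ∀ x → p x ≡ true
  allFin-elim {k} p all≡true x = T⇒≡ (All.lookup (all⁺ p (List.allFin k) (≡⇒T all≡true)) (∈-allFin x))

  iverson : Bool → ℕ
  iverson true  = 1
  iverson false = 0

  count : ∀ {k} → (Fin k → Bool) → ℕ
  count {k} p = ∑[ x < k ] iverson (p x)

  countFin≡count : ∀ {k} (p : Fin k → Bool) → countFin p ≡ count p
  countFin≡count p = go p (λ x → x)
    where
    go : ∀ {k} {A : Set} (p : A → Bool) (f : Fin k → A) →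
      length (filter (λ x → Dec.T? (p x)) (tabulate f)) ≡ count (p ∘ f)
    go {zero}  p f = refl
    go {suc k} p f with p (f zero)
    ... | true  = cong suc (go p (f ∘ suc))
    ... | false = go p (f ∘ suc)

  count-cong : ∀ {k} {p q : Fin k → Bool} → (∀ x → p x ≡ q x) → count p ≡ count q
  count-cong p≗q = sum-cong-≗ (cong iverson ∘ p≗q)

  count≤ : ∀ {k} (p : Fin k → Bool) → count p ≤ k
  count≤ {zero}  p = z≤n
  count≤ {suc k} p with p zero
  ... | true  = s≤s (count≤ (p ∘ suc))
  ... | false = ℕ.m≤n⇒m≤1+n (count≤ (p ∘ suc))

  count-mono : ∀ {k} (p q : Fin k → Bool) → (∀ x → p x ≡ true → q x ≡ true) → count p ≤ count q
  count-mono {zero}  p q p⇒q = z≤n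
  count-mono {suc k} p q p⇒q with p zero in p₀ | q zero in q₀
  ... | true  | true  = s≤s (count-mono (p ∘ suc) (q ∘ suc) (p⇒q ∘ suc))
  ... | true  | false = ⊥-elim (true≢false (p⇒q zero p₀) q₀)
  ... | false | true  = ℕ.m≤n⇒m≤1+n (count-mono (p ∘ suc) (q ∘ suc) (p⇒q ∘ suc))
  ... | false | false = count-mono (p ∘ suc) (q ∘ suc) (p⇒q ∘ suc)

  count-insert : ∀ {k} (p q : Fin k → Bool) x → (∀ y → y ≢ x → p y ≡ q y) → p x ≡ false →
    count q ≡ count p + iverson (q x)
  count-insert {suc k} p q zero    p≗q px rewrite px =
    trans (cong (iverson (q zero) +_) (count-cong (λ y → sym (p≗q (suc y) (λ ()))))) (ℕ.+-comm (iverson (q zero)) _)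
  count-insert {suc k} p q (suc x) p≗q px rewrite p≗q zero (λ ()) =
    trans (cong (iverson (q zero) +_)
                (count-insert (p ∘ suc) (q ∘ suc) x (λ y y≢x → p≗q (suc y) (y≢x ∘ Fin.suc-injective)) px))
          (sym (ℕ.+-assoc (iverson (q zero)) _ _))

  count-strict : ∀ {k} (p q : Fin k → Bool) → (∀ x → p x ≡ true → q x ≡ true) →
    ∀ x → q x ≡ true → p x ≡ false → suc (count p) ≤ count q
  count-strict p q p⇒q x qx px = begin
    suc (count p)          ≡⟨ ℕ.+-comm 1 (count p) ⟩
    count p + 1            ≡⟨ cong (λ b → count p + iverson b) (cong₂ _∨_ px (==-refl x)) ⟨
    count p + iverson (p x ∨ (x == x)) ≡⟨ count-insert p (λ y → p y ∨ (x == y)) x extends px ⟨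
    count (λ y → p y ∨ (x == y)) ≤⟨ count-mono _ q into-q ⟩
    count q ∎
    where
    open ℕ.≤-Reasoning
    extends : ∀ y → y ≢ x → p y ≡ p y ∨ (x == y)
    extends y y≢x = trans (sym (Bool.∨-identityʳ (p y))) (cong (p y ∨_) (sym (≢⇒== (y≢x ∘ sym))))
    into-q : ∀ y → p y ∨ (x == y) ≡ true → q y ≡ true
    into-q y py∨x=y with ∨-elim (p y) py∨x=y
    ... | inj₁ py  = p⇒q y py
    ... | inj₂ x=y = subst (λ z → q z ≡ true) (==⇒≡ x=y) qx

  count-pos : ∀ {k} (p : Fin k → Bool) x → p x ≡ true → 1 ≤ count p
  count-pos p x px = ℕ.≤-trans (s≤s z≤n) (count-strict (λ _ → false) p (λ _ ()) x px refl)

  count-zero : ∀ {k} (p : Fin k → Bool) → (∀ x → p x ≡ false) → count p ≡ 0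
  count-zero {zero}  p p≡false = refl
  count-zero {suc k} p p≡false rewrite p≡false zero = count-zero (p ∘ suc) (p≡false ∘ suc)

  count-zero⁻¹ : ∀ {k} (p : Fin k → Bool) → count p ≡ 0 → ∀ x → p x ≡ false
  count-zero⁻¹ p count≡0 x =
    Bool.¬-not (λ px → ℕ.<-irrefl refl (ℕ.≤-trans (count-pos p x px) (ℕ.≤-reflexive count≡0)))

  count-all : ∀ {k} (p : Fin k → Bool) → (∀ x → p x ≡ true) → count p ≡ k
  count-all {zero}  p p≡true = refl
  count-all {suc k} p p≡true rewrite p≡true zero = cong suc (count-all (p ∘ suc) (p≡true ∘ suc))

  count-split : ∀ {k} (p q : Fin k → Bool) → count p ≡ count (λ x → p x ∧ q x) + count (λ x → p x ∧ not (q x))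
  count-split {zero}  p q = refl
  count-split {suc k} p q with p zero | q zero
  ... | true  | true  = cong suc (count-split (p ∘ suc) (q ∘ suc))
  ... | true  | false = trans (cong suc (count-split (p ∘ suc) (q ∘ suc))) (sym (ℕ.+-suc _ _))
  ... | false | true  = count-split (p ∘ suc) (q ∘ suc)
  ... | false | false = count-split (p ∘ suc) (q ∘ suc)

  count-two : ∀ {k} (p : Fin k → Bool) x y → x ≢ y → p x ≡ true → p y ≡ true → 2 ≤ count p
  count-two p x y x≢y px py = ℕ.≤-trans (s≤s (count-pos (_== x) x (==-refl x)))
    (count-strict (_== x) p (λ z z=x → subst (λ w → p w ≡ true) (sym (==⇒≡ z=x)) px) y py (≢⇒== (x≢y ∘ sym)))

  sum-zero : ∀ {k} (g : Fin k → ℕ) → (∀ x → g x ≡ 0) → sum g ≡ 0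
  sum-zero {zero}  g g≡0 = refl
  sum-zero {suc k} g g≡0 rewrite g≡0 zero = sum-zero (g ∘ suc) (g≡0 ∘ suc)

  sum-mono : ∀ {k} (f g : Fin k → ℕ) → (∀ x → f x ≤ g x) → sum f ≤ sum g
  sum-mono {zero}  f g f≤g = z≤n
  sum-mono {suc k} f g f≤g = ℕ.+-mono-≤ (f≤g zero) (sum-mono (f ∘ suc) (g ∘ suc) (f≤g ∘ suc))

  sum-tight : ∀ {k} (f g : Fin k → ℕ) → (∀ x → f x ≤ g x) → sum g ≤ sum f → ∀ x → g x ≡ f x
  sum-tight {suc k} f g f≤g ∑g≤∑f zero = ℕ.≤-antisym
    (ℕ.+-cancelʳ-≤ _ _ _ (ℕ.≤-trans ∑g≤∑f (ℕ.+-monoʳ-≤ (f zero) (sum-mono (f ∘ suc) (g ∘ suc) (f≤g ∘ suc)))))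
    (f≤g zero)
  sum-tight {suc k} f g f≤g ∑g≤∑f (suc x) = sum-tight (f ∘ suc) (g ∘ suc) (f≤g ∘ suc)
    (ℕ.+-cancelˡ-≤ (g zero) _ _ (ℕ.≤-trans ∑g≤∑f (ℕ.+-monoˡ-≤ (sum (f ∘ suc)) (f≤g zero)))) x

  sum-point : ∀ {k} (Q : Fin k → Bool) x → ∑[ v < k ] iverson (Q v ∧ (x == v)) ≡ iverson (Q x)
  sum-point {k} Q x = begin
    count (λ v → Q v ∧ (x == v))
      ≡⟨ count-insert (λ _ → false) (λ v → Q v ∧ (x == v)) x off-x refl ⟩
    count {k} (λ _ → false) + iverson (Q x ∧ (x == x))
      ≡⟨ cong₂ (λ c b → c + iverson (Q x ∧ b)) (count-zero {k} (λ _ → false) (λ _ → refl)) (==-refl x) ⟩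
    iverson (Q x ∧ true)
      ≡⟨ cong iverson (Bool.∧-identityʳ (Q x)) ⟩
    iverson (Q x) ∎
    where
    open ≡-Reasoning
    off-x : ∀ y → y ≢ x → false ≡ Q y ∧ (x == y)
    off-x y y≢x = sym (trans (cong (Q y ∧_) (≢⇒== (y≢x ∘ sym))) (Bool.∧-zeroʳ (Q y)))

  sum-fibres : ∀ {k m} (P : Fin m → Fin k → Bool) (f : Fin m → Fin k) →
    ∑[ v < k ] count (λ e → P e v ∧ (f e == v)) ≡ count (λ e → P e (f e))
  sum-fibres P f = trans (∑-comm (λ v e → iverson (P e v ∧ (f e == v)))) (sum-cong-≗ (λ e → sum-point (P e) (f e)))

  sum-even : ∀ {k} (g : Fin k → ℕ) → (∀ v → g v ≡ 0 ⊎ g v ≡ 2) → ∃ λ t → sum g ≡ 2 * t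
  sum-even {zero}  g g∈02 = 0 , refl
  sum-even {suc k} g g∈02 with sum-even (g ∘ suc) (g∈02 ∘ suc) | g∈02 zero
  ... | t , ∑≡2t | inj₁ g₀≡0 = t , trans (cong₂ _+_ g₀≡0 ∑≡2t) refl
  ... | t , ∑≡2t | inj₂ g₀≡2 = suc t , trans (cong₂ _+_ g₀≡2 ∑≡2t) (sym (ℕ.*-suc 2 t))

open FinCounting

module EdgeSets where

  open import Data.Nat using (_+_; _≤_)

  infix 5 _⊆_ _⊆ᵇ_

  _⊆_ : ∀ {m} → Subset m → Subset m → Set
  A ⊆ B = ∀ e → e ∈ᵇ A ≡ true → e ∈ᵇ B ≡ true

  ∈-remove-self : ∀ {k} (A : Subset k) e → e ∈ᵇ remove A e ≡ false
  ∈-remove-self A e = Vec.lookup∘update e A outside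

  ∈-remove-other : ∀ {k} (A : Subset k) {e f} → f ≢ e → f ∈ᵇ remove A e ≡ f ∈ᵇ A
  ∈-remove-other A f≢e = Vec.lookup∘update′ f≢e A outside

  remove-⊆ : ∀ {k} (A : Subset k) e → remove A e ⊆ A
  remove-⊆ A e f f∈A-e with f Fin.≟ e
  ... | yes refl = ⊥-elim (true≢false f∈A-e (∈-remove-self A e))
  ... | no  f≢e  = trans (sym (∈-remove-other A f≢e)) f∈A-e

  remove-mono : ∀ {k} (C A : Subset k) → C ⊆ A → ∀ e → remove C e ⊆ remove A e
  remove-mono C A C⊆A e f f∈C-e with f Fin.≟ e
  ... | yes refl = ⊥-elim (true≢false f∈C-e (∈-remove-self C e))
  ... | no  f≢e  = trans (∈-remove-other A f≢e) (C⊆A f (trans (sym (∈-remove-other C f≢e)) f∈C-e))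

  ⊆-remove : ∀ {k} (C A : Subset k) e → C ⊆ A → e ∈ᵇ C ≡ false → C ⊆ remove A e
  ⊆-remove C A e C⊆A e∉C f f∈C with f Fin.≟ e
  ... | yes refl = ⊥-elim (true≢false f∈C e∉C)
  ... | no  f≢e  = trans (∈-remove-other A f≢e) (C⊆A f f∈C)

  ∣remove∣ : ∀ {k} (A : Subset k) e → e ∈ᵇ A ≡ true → ∣ A ∣ ≡ suc ∣ remove A e ∣
  ∣remove∣ (true ∷ A) zero    _   = refl
  ∣remove∣ (x    ∷ A) (suc e) e∈A with x
  ... | true  = cong suc (∣remove∣ A e e∈A)
  ... | false = ∣remove∣ A e e∈A

  count-remove : ∀ {k} (C : Subset k) e → e ∈ᵇ C ≡ true → ∀ (q : Fin k → Bool) →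
    count (λ f → f ∈ᵇ C ∧ q f) ≡ count (λ f → f ∈ᵇ remove C e ∧ q f) + iverson (q e)
  count-remove C e e∈C q =
    trans (count-insert (λ f → f ∈ᵇ remove C e ∧ q f) (λ f → f ∈ᵇ C ∧ q f) e
                        (λ f f≢e → cong (_∧ q f) (∈-remove-other C f≢e)) (cong (_∧ q e) (∈-remove-self C e)))
          (cong (λ b → count (λ f → f ∈ᵇ remove C e ∧ q f) + iverson (b ∧ q e)) e∈C)

  ∣∣≡count : ∀ {k} (A : Subset k) → ∣ A ∣ ≡ count (_∈ᵇ A)
  ∣∣≡count []          = refl
  ∣∣≡count (true  ∷ A) = cong suc (∣∣≡count A)
  ∣∣≡count (false ∷ A) = ∣∣≡count A

  ⊆⇒∣∣≤ : ∀ {k} (A B : Subset k) → A ⊆ B → ∣ A ∣ ≤ ∣ B ∣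
  ⊆⇒∣∣≤ A B A⊆B = p⊆q⇒∣p∣≤∣q∣ {p = A} (λ {e} e∈A → Vec.lookup⇒[]= e B (A⊆B e (Vec.[]=⇒lookup e∈A)))

  nonempty : ∀ {k} (A : Subset k) {j} → ∣ A ∣ ≡ suc j → ∃ λ e → e ∈ᵇ A ≡ true
  nonempty A ∣A∣≡1+j with Fin.any? (λ e → e ∈ᵇ A Bool.≟ true)
  ... | yes some = some
  ... | no  none = ⊥-elim (ℕ.0≢1+n (trans (sym (count-zero _ (λ e → Bool.¬-not (λ e∈A → none (e , e∈A)))))
                                          (trans (sym (∣∣≡count A)) ∣A∣≡1+j)))

  subset-ext : ∀ {k} {A B : Subset k} → (∀ e → e ∈ᵇ A ≡ e ∈ᵇ B) → A ≡ B
  subset-ext {A = []}    {[]}    _   = refl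
  subset-ext {A = x ∷ A} {y ∷ B} A≗B = cong₂ _∷_ (A≗B zero) (subset-ext (A≗B ∘ suc))

  ⊆-fullSet : ∀ {k} (A : Subset k) → A ⊆ fullSet
  ⊆-fullSet A e _ = Vec.lookup-replicate e inside

  -- Inclusion computed along the vectors, so that it reduces on the subsets listed by allSubsets.
  _⊆ᵇ_ : ∀ {m} → Subset m → Subset m → Bool
  []      ⊆ᵇ []      = true
  (c ∷ C) ⊆ᵇ (a ∷ A) = (not c ∨ a) ∧ (C ⊆ᵇ A)

  ⊆ᵇ⇒⊆ : ∀ {m} (C A : Subset m) → C ⊆ᵇ A ≡ true → C ⊆ A
  ⊆ᵇ⇒⊆ (c ∷ C) (a ∷ A) C⊆A zero    refl = ∧-elimˡ a C⊆A
  ⊆ᵇ⇒⊆ (c ∷ C) (a ∷ A) C⊆A (suc e) e∈C  = ⊆ᵇ⇒⊆ C A (∧-elimʳ (not c ∨ a) C⊆A) e e∈C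

  ⊆⇒⊆ᵇ : ∀ {m} (C A : Subset m) → C ⊆ A → C ⊆ᵇ A ≡ true
  ⊆⇒⊆ᵇ []          []      _   = refl
  ⊆⇒⊆ᵇ (true  ∷ C) (a ∷ A) C⊆A = ∧-intro (C⊆A zero refl) (⊆⇒⊆ᵇ C A (λ e → C⊆A (suc e)))
  ⊆⇒⊆ᵇ (false ∷ C) (a ∷ A) C⊆A = ⊆⇒⊆ᵇ C A (λ e → C⊆A (suc e))

open EdgeSets

module GraphTheory {n m : ℕ} (G : Graph n m) where

  open import Data.Nat using (_+_; _*_; _∸_; _≤_; _<_)
  open import Data.Nat.Tactic.RingSolver using (solve-∀)

  -- Walks and connectivity

  end₁ end₂ : Fin m → Fin n
  end₁ e = proj₁ (ends G e)
  end₂ e = proj₂ (ends G e)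

  step : Subset m → (Fin n → Bool) → Fin n → Fin m → Bool
  step A X v e = e ∈ᵇ A ∧ ((X (end₁ e) ∧ (end₂ e == v)) ∨ (X (end₂ e) ∧ (end₁ e == v)))

  reach-refl : ∀ A s u → reach G A s u u ≡ true
  reach-refl A zero    u = ==-refl u
  reach-refl A (suc s) u = ∨-introˡ (reach-refl A s u)

  reach-suc : ∀ A s u v → reach G A s u v ≡ true → reach G A (suc s) u v ≡ true
  reach-suc A s u v = ∨-introˡ

  reach-≤ : ∀ A {s t} u v → s ≤ t → reach G A s u v ≡ true → reach G A t u v ≡ true
  reach-≤ A {s} {t} u v s≤t r with ℕ.m≤n⇒m<n∨m≡n s≤t
  ... | inj₂ refl = r
  ... | inj₁ s<t with t
  ...   | suc t = reach-suc A t u v (reach-≤ A u v (ℕ.≤-pred s<t) r)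

  reach-edge₁ : ∀ A s u e → e ∈ᵇ A ≡ true → reach G A s u (end₁ e) ≡ true → reach G A (suc s) u (end₂ e) ≡ true
  reach-edge₁ A s u e e∈A r = ∨-introʳ (reach G A s u (end₂ e))
    (anyFin-intro (step A (reach G A s u) (end₂ e)) e (∧-intro e∈A (∨-introˡ (∧-intro r (==-refl (end₂ e))))))

  reach-edge₂ : ∀ A s u e → e ∈ᵇ A ≡ true → reach G A s u (end₂ e) ≡ true → reach G A (suc s) u (end₁ e) ≡ true
  reach-edge₂ A s u e e∈A r = ∨-introʳ (reach G A s u (end₁ e))
    (anyFin-intro (step A (reach G A s u) (end₁ e)) e
      (∧-intro e∈A (∨-introʳ (reach G A s u (end₁ e) ∧ (end₂ e == end₁ e)) (∧-intro r (==-refl (end₁ e))))))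

  data Step (A : Subset m) (X : Fin n → Bool) (v : Fin n) : Set where
    forward  : ∀ e → e ∈ᵇ A ≡ true → X (end₁ e) ≡ true → end₂ e ≡ v → Step A X v
    backward : ∀ e → e ∈ᵇ A ≡ true → X (end₂ e) ≡ true → end₁ e ≡ v → Step A X v

  reach-inv : ∀ A s u v → reach G A (suc s) u v ≡ true → reach G A s u v ≡ true ⊎ Step A (reach G A s u) v
  reach-inv A s u v r with ∨-elim (reach G A s u v) r
  ... | inj₁ r′ = inj₁ r′
  ... | inj₂ some with anyFin-elim (step A (reach G A s u) v) some
  ...   | e , stp with ∨-elim (reach G A s u (end₁ e) ∧ (end₂ e == v)) (∧-elimʳ (e ∈ᵇ A) stp)
  ...     | inj₁ fw = inj₂ (forward e (∧-elimˡ (e ∈ᵇ A) stp) (∧-elimˡ (reach G A s u (end₁ e)) fw)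
                                      (==⇒≡ (∧-elimʳ (reach G A s u (end₁ e)) fw)))
  ...     | inj₂ bw = inj₂ (backward e (∧-elimˡ (e ∈ᵇ A) stp) (∧-elimˡ (reach G A s u (end₂ e)) bw)
                                       (==⇒≡ (∧-elimʳ (reach G A s u (end₂ e)) bw)))

  reach-trans : ∀ A s t u v w → reach G A s u v ≡ true → reach G A t v w ≡ true → reach G A (t + s) u w ≡ true
  reach-trans A s zero    u v w r q = subst (λ z → reach G A s u z ≡ true) (==⇒≡ q) r
  reach-trans A s (suc t) u v w r q with reach-inv A t v w q
  ... | inj₁ q′                      = reach-suc A (t + s) u w (reach-trans A s t u v w r q′)
  ... | inj₂ (forward  e e∈A x refl) = reach-edge₁ A (t + s) u e e∈A (reach-trans A s t u v (end₁ e) r x)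
  ... | inj₂ (backward e e∈A x refl) = reach-edge₂ A (t + s) u e e∈A (reach-trans A s t u v (end₂ e) r x)

  reach-sym : ∀ A s u v → reach G A s u v ≡ true → reach G A s v u ≡ true
  reach-sym A zero    u v r = ≡⇒== (sym (==⇒≡ r))
  reach-sym A (suc s) u v r with reach-inv A s u v r
  ... | inj₁ r′ = reach-suc A s v u (reach-sym A s u v r′)
  ... | inj₂ (forward e e∈A x refl) = subst (λ z → reach G A z (end₂ e) u ≡ true) (ℕ.+-comm s 1)
    (reach-trans A 1 s (end₂ e) (end₁ e) u (reach-edge₂ A 0 (end₂ e) e e∈A (==-refl (end₂ e))) (reach-sym A s u (end₁ e) x))
  ... | inj₂ (backward e e∈A x refl) = subst (λ z → reach G A z (end₁ e) u ≡ true) (ℕ.+-comm s 1)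
    (reach-trans A 1 s (end₁ e) (end₂ e) u (reach-edge₁ A 0 (end₁ e) e e∈A (==-refl (end₁ e))) (reach-sym A s u (end₂ e) x))

  reach-mono : ∀ A B → A ⊆ B → ∀ s u v → reach G A s u v ≡ true → reach G B s u v ≡ true
  reach-mono A B A⊆B zero    u v r = r
  reach-mono A B A⊆B (suc s) u v r with reach-inv A s u v r
  ... | inj₁ r′ = reach-suc B s u v (reach-mono A B A⊆B s u v r′)
  ... | inj₂ (forward  e e∈A x refl) = reach-edge₁ B s u e (A⊆B e e∈A) (reach-mono A B A⊆B s u (end₁ e) x)
  ... | inj₂ (backward e e∈A x refl) = reach-edge₂ B s u e (A⊆B e e∈A) (reach-mono A B A⊆B s u (end₂ e) x)

  Stable : Subset m → ℕ → Fin n → Set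
  Stable A s u = ∀ v → reach G A (suc s) u v ≡ reach G A s u v

  reach-suc-cong : ∀ A s s′ u → (∀ v → reach G A s u v ≡ reach G A s′ u v) →
    ∀ v → reach G A (suc s) u v ≡ reach G A (suc s′) u v
  reach-suc-cong A s s′ u s≗s′ v = cong₂ _∨_ (s≗s′ v) (anyFin-cong (λ e →
    cong (λ b → e ∈ᵇ A ∧ b) (cong₂ _∨_ (cong (_∧ (end₂ e == v)) (s≗s′ (end₁ e)))
                                       (cong (_∧ (end₁ e == v)) (s≗s′ (end₂ e))))))

  stable-forever : ∀ A s u → Stable A s u → ∀ t v → reach G A (t + s) u v ≡ reach G A s u v
  stable-forever A s u stable zero    v = refl
  stable-forever A s u stable (suc t) v =
    trans (reach-suc-cong A (t + s) s u (stable-forever A s u stable t) v) (stable v)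

  stable-or-growing : ∀ A u s → s ≤ n → (∃ λ s′ → s′ < s × Stable A s′ u) ⊎ suc s ≤ count (reach G A s u)
  stable-or-growing A u zero    _   = inj₂ (count-pos _ u (reach-refl A 0 u))
  stable-or-growing A u (suc s) s<n with stable-or-growing A u s (ℕ.≤-trans (ℕ.n≤1+n s) s<n)
  ... | inj₁ (s′ , s′<s , stable) = inj₁ (s′ , ℕ.m<n⇒m<1+n s′<s , stable)
  ... | inj₂ growing with Fin.all? (λ v → reach G A (suc s) u v Bool.≟ reach G A s u v)
  ...   | yes stable = inj₁ (s , ℕ.≤-refl , stable)
  ...   | no ¬stable with Fin.¬∀⟶∃¬ n _ (λ v → reach G A (suc s) u v Bool.≟ reach G A s u v) ¬stable
  ...     | v , new = inj₂ (ℕ.≤-trans (s≤s growing) (count-strict _ _ (reach-suc A s u) v (proj₁ v-new) (proj₂ v-new)))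
    where
    newly : ∀ {a b} → (a ≡ true → b ≡ true) → b ≢ a → b ≡ true × a ≡ false
    newly {true}  a⇒b b≢a = ⊥-elim (b≢a (a⇒b refl))
    newly {false} a⇒b b≢a = Bool.¬-not b≢a , refl
    v-new = newly (reach-suc A s u v) new

  -- Until the set reached from u stops changing it grows at every step, so walks of length n suffice.
  reach⇒connected : ∀ A t u v → reach G A t u v ≡ true → connected G A u v ≡ true
  reach⇒connected A t u v r with stable-or-growing A u n ℕ.≤-refl
  ... | inj₂ growing = ⊥-elim (ℕ.<-irrefl refl (ℕ.≤-trans growing (count≤ _)))
  ... | inj₁ (s , s<n , stable) with t ℕ.≤? n
  ...   | yes t≤n = reach-≤ A u v t≤n r
  ...   | no  t≰n = reach-≤ A u v (ℕ.<⇒≤ s<n)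
    (trans (sym (trans (cong (λ z → reach G A z u v) (sym (ℕ.m∸n+n≡m s≤t))) (stable-forever A s u stable (t ℕ.∸ s) v))) r)
    where
    s≤t : s ≤ t
    s≤t = ℕ.≤-trans (ℕ.<⇒≤ s<n) (ℕ.<⇒≤ (ℕ.≰⇒> t≰n))

  Connected : Subset m → Fin n → Fin n → Set
  Connected A u v = connected G A u v ≡ true

  connected-refl : ∀ A u → Connected A u u
  connected-refl A u = reach-refl A n u

  connected-sym : ∀ A {u v} → Connected A u v → Connected A v u
  connected-sym A {u} {v} = reach-sym A n u v

  connected-trans : ∀ A {u v w} → Connected A u v → Connected A v w → Connected A u w
  connected-trans A {u} {v} {w} c d = reach⇒connected A (n + n) u w (reach-trans A n n u v w c d)

  connected-edge : ∀ A e → e ∈ᵇ A ≡ true → Connected A (end₁ e) (end₂ e)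
  connected-edge A e e∈A = reach⇒connected A 1 (end₁ e) (end₂ e) (reach-edge₁ A 0 (end₁ e) e e∈A (==-refl (end₁ e)))

  connected-mono : ∀ A B → A ⊆ B → ∀ {u v} → Connected A u v → Connected B u v
  connected-mono A B A⊆B {u} {v} = reach-mono A B A⊆B n u v

  connected-ind : ∀ A u (Q : Fin n → Set) → Q u →
    (∀ e → e ∈ᵇ A ≡ true → (Q (end₁ e) → Q (end₂ e)) × (Q (end₂ e) → Q (end₁ e))) →
    ∀ v → Connected A u v → Q v
  connected-ind A u Q Qu closed v = go n v
    where
    go : ∀ s v → reach G A s u v ≡ true → Q v
    go zero    v r = subst Q (==⇒≡ r) Qu
    go (suc s) v r with reach-inv A s u v r
    ... | inj₁ r′                      = go s v r′
    ... | inj₂ (forward  e e∈A x refl) = proj₁ (closed e e∈A) (go s (end₁ e) x)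
    ... | inj₂ (backward e e∈A x refl) = proj₂ (closed e e∈A) (go s (end₂ e) x)

  -- Connected components

  isRoot : Subset m → Fin n → Bool
  isRoot A v = not (anyFin (λ u → ⌊ toℕ u ℕ.<? toℕ v ⌋ ∧ connected G A u v))

  ncomp≡count-isRoot : ∀ A → ncomp G A ≡ count (isRoot A)
  ncomp≡count-isRoot A = countFin≡count (isRoot A)

  ncomp≤n : ∀ A → ncomp G A ≤ n
  ncomp≤n A = subst (_≤ n) (sym (ncomp≡count-isRoot A)) (count≤ (isRoot A))

  isRoot-elim : ∀ A {v} → isRoot A v ≡ true → ∀ u → toℕ u < toℕ v → ¬ Connected A u v
  isRoot-elim A {v} root u u<v c = true≢false
    (anyFin-intro _ u (∧-intro (⌊⌋-true (toℕ u ℕ.<? toℕ v) u<v) c))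
    (not-true root)

  isRoot-intro : ∀ A v → (∀ u → toℕ u < toℕ v → ¬ Connected A u v) → isRoot A v ≡ true
  isRoot-intro A v minimal = cong not (anyFin-false _ none)
    where
    none : ¬ (∃ λ u → ⌊ toℕ u ℕ.<? toℕ v ⌋ ∧ connected G A u v ≡ true)
    none (u , u<v∧c) = minimal u (⌊⌋⇒ (toℕ u ℕ.<? toℕ v) (∧-elimˡ _ u<v∧c)) (∧-elimʳ _ u<v∧c)

  isRoot-false : ∀ A {v} → isRoot A v ≡ false → ∃ λ u → toℕ u < toℕ v × Connected A u v
  isRoot-false A {v} notRoot with anyFin-elim _ (Bool.not-injective notRoot)
  ... | u , u<v∧c = u , ⌊⌋⇒ (toℕ u ℕ.<? toℕ v) (∧-elimˡ _ u<v∧c) , ∧-elimʳ _ u<v∧c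

  root-exists : ∀ A v → ∃ λ r → isRoot A r ≡ true × Connected A r v
  root-exists A v = go (suc (toℕ v)) v ℕ.≤-refl
    where
    go : ∀ k v → toℕ v < k → ∃ λ r → isRoot A r ≡ true × Connected A r v
    go (suc k) v v<k with isRoot A v in root
    ... | true  = v , root , connected-refl A v
    ... | false with isRoot-false A root
    ...   | u , u<v , c with go k u (ℕ.≤-trans u<v (ℕ.≤-pred v<k))
    ...     | r , r-root , r~u = r , r-root , connected-trans A r~u c

  root-unique : ∀ A {x y} → isRoot A x ≡ true → isRoot A y ≡ true → Connected A x y → x ≡ y
  root-unique A {x} {y} x-root y-root x~y with ℕ.<-cmp (toℕ x) (toℕ y)
  ... | tri< x<y _ _ = ⊥-elim (isRoot-elim A y-root x x<y x~y)
  ... | tri≈ _ x≡y _ = Fin.toℕ-injective x≡y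
  ... | tri> _ _ y<x = ⊥-elim (isRoot-elim A x-root y y<x (connected-sym A x~y))

  _⊑_ : Subset m → Subset m → Set
  A ⊑ B = ∀ {u v} → Connected A u v → Connected B u v

  isRoot-anti : ∀ {A B} → A ⊑ B → ∀ v → isRoot B v ≡ true → isRoot A v ≡ true
  isRoot-anti {A} {B} A⊑B v root = isRoot-intro A v (λ u u<v c → isRoot-elim B root u u<v (A⊑B c))

  ncomp-anti : ∀ {A B} → A ⊑ B → ncomp G B ≤ ncomp G A
  ncomp-anti {A} {B} A⊑B rewrite ncomp≡count-isRoot A | ncomp≡count-isRoot B =
    count-mono (isRoot B) (isRoot A) (isRoot-anti A⊑B)

  -- u and v are connected in A once a and b are identified.
  Glued : Subset m → Fin n → Fin n → Fin n → Fin n → Set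
  Glued A a b u v = Connected A u v ⊎ (Connected A u a × Connected A b v) ⊎ (Connected A u b × Connected A a v)

  Glued-sym : ∀ {A a b u v} → Glued A a b u v → Glued A b a u v
  Glued-sym (inj₁ c)        = inj₁ c
  Glued-sym (inj₂ (inj₁ c)) = inj₂ (inj₂ c)
  Glued-sym (inj₂ (inj₂ c)) = inj₂ (inj₁ c)

  ncomp-glue-connected : ∀ {A B a b} → A ⊑ B → (∀ {u v} → Connected B u v → Glued A a b u v) →
    Connected A a b → ncomp G B ≡ ncomp G A
  ncomp-glue-connected {A} {B} {a} {b} A⊑B B⊑glued a~b = ℕ.≤-antisym (ncomp-anti A⊑B) (ncomp-anti B⊑A)
    where
    B⊑A : B ⊑ A
    B⊑A c with B⊑glued c
    ... | inj₁ u~v               = u~v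
    ... | inj₂ (inj₁ (u~a , b~v)) = connected-trans A u~a (connected-trans A a~b b~v)
    ... | inj₂ (inj₂ (u~b , a~v)) = connected-trans A u~b (connected-trans A (connected-sym A a~b) a~v)

  private
    ncomp-glue-ordered : ∀ {A B a b ra rb} → A ⊑ B → Connected B a b → (∀ {u v} → Connected B u v → Glued A a b u v) →
      isRoot A ra ≡ true → Connected A ra a → isRoot A rb ≡ true → Connected A rb b → toℕ ra < toℕ rb →
      ncomp G A ≡ suc (ncomp G B)
    ncomp-glue-ordered {A} {B} {a} {b} {ra} {rb} A⊑B a~b B⊑glued ra-root ra~a rb-root rb~b ra<rb = begin
      ncomp G A                              ≡⟨ ncomp≡count-isRoot A ⟩
      count (isRoot A)                       ≡⟨ count-insert (isRoot B) (isRoot A) rb agree rb-not-B-root ⟩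
      count (isRoot B) + iverson (isRoot A rb) ≡⟨ cong (λ c → count (isRoot B) + iverson c) rb-root ⟩
      count (isRoot B) + 1                   ≡⟨ ℕ.+-comm _ 1 ⟩
      suc (count (isRoot B))                 ≡⟨ cong suc (ncomp≡count-isRoot B) ⟨
      suc (ncomp G B)                        ∎
      where
      open ≡-Reasoning
      ra~rb : Connected B ra rb
      ra~rb = connected-trans B (A⊑B ra~a) (connected-trans B a~b (A⊑B (connected-sym A rb~b)))
      rb-not-B-root : isRoot B rb ≡ false
      rb-not-B-root = Bool.¬-not (λ root → isRoot-elim B root ra ra<rb ra~rb)
      still-root : ∀ x → x ≢ rb → isRoot A x ≡ true → isRoot B x ≡ true
      still-root x x≢rb x-root = isRoot-intro B x below
        where
        below : ∀ u → toℕ u < toℕ x → ¬ Connected B u x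
        below u u<x u~x with B⊑glued u~x
        ... | inj₁ u~x′ = isRoot-elim A x-root u u<x u~x′
        ... | inj₂ (inj₁ (_ , b~x)) =
          x≢rb (root-unique A x-root rb-root (connected-trans A (connected-sym A b~x) (connected-sym A rb~b)))
        ... | inj₂ (inj₂ (u~b , a~x)) =
          isRoot-elim A rb-root u (ℕ.<-trans u<x x<rb) (connected-trans A u~b (connected-sym A rb~b))
          where
          x<rb : toℕ x < toℕ rb
          x<rb = subst (λ z → toℕ z < toℕ rb)
                   (sym (root-unique A x-root ra-root (connected-trans A (connected-sym A a~x) (connected-sym A ra~a)))) ra<rb
      agree : ∀ y → y ≢ rb → isRoot B y ≡ isRoot A y
      agree y y≢rb = bool-ext (isRoot-anti A⊑B y) (still-root y y≢rb)

  ncomp-glue-separated : ∀ {A B a b} → A ⊑ B → Connected B a b → (∀ {u v} → Connected B u v → Glued A a b u v) →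
    ¬ Connected A a b → ncomp G A ≡ suc (ncomp G B)
  ncomp-glue-separated {A} {B} {a} {b} A⊑B a~b B⊑glued a≁b with root-exists A a | root-exists A b
  ... | ra , ra-root , ra~a | rb , rb-root , rb~b with ℕ.<-cmp (toℕ ra) (toℕ rb)
  ...   | tri< ra<rb _ _ = ncomp-glue-ordered A⊑B a~b B⊑glued ra-root ra~a rb-root rb~b ra<rb
  ...   | tri≈ _ ra≡rb _ = ⊥-elim (a≁b (connected-trans A (connected-sym A ra~a)
                             (subst (λ r → Connected A r b) (sym (Fin.toℕ-injective ra≡rb)) rb~b)))
  ...   | tri> _ _ rb<ra = ncomp-glue-ordered A⊑B (connected-sym B a~b) (Glued-sym ∘ B⊑glued) rb-root rb~b ra-root ra~a rb<ra

  -- Edge removal, rank and corank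

  Glued-extend : ∀ {A a b u x y} → Connected A x y → Glued A a b u x → Glued A a b u y
  Glued-extend {A} x~y (inj₁ u~x)               = inj₁ (connected-trans A u~x x~y)
  Glued-extend {A} x~y (inj₂ (inj₁ (u~a , b~x))) = inj₂ (inj₁ (u~a , connected-trans A b~x x~y))
  Glued-extend {A} x~y (inj₂ (inj₂ (u~b , a~x))) = inj₂ (inj₂ (u~b , connected-trans A a~x x~y))

  remove-glued : ∀ A e → e ∈ᵇ A ≡ true → ∀ {u v} → Connected A u v → Glued (remove A e) (end₁ e) (end₂ e) u v
  remove-glued A e e∈A {u} {v} = connected-ind A u (Glued A′ a b u) (inj₁ (connected-refl A′ u)) closed v
    where
    A′ = remove A e
    a  = end₁ e
    b  = end₂ e
    closed : ∀ f → f ∈ᵇ A ≡ true → (Glued A′ a b u (end₁ f) → Glued A′ a b u (end₂ f)) ×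
                                   (Glued A′ a b u (end₂ f) → Glued A′ a b u (end₁ f))
    closed f f∈A with f Fin.≟ e
    ... | no f≢e = Glued-extend f~ , Glued-extend (connected-sym A′ f~)
      where f~ = connected-edge A′ f (trans (∈-remove-other A f≢e) f∈A)
    ... | yes refl = across , back
      where
      across : Glued A′ a b u a → Glued A′ a b u b
      across (inj₁ u~a)               = inj₂ (inj₁ (u~a , connected-refl A′ b))
      across (inj₂ (inj₁ (u~a , b~a))) = inj₁ (connected-trans A′ u~a (connected-sym A′ b~a))
      across (inj₂ (inj₂ (u~b , _)))   = inj₁ u~b
      back : Glued A′ a b u b → Glued A′ a b u a
      back (inj₁ u~b)               = inj₂ (inj₂ (u~b , connected-refl A′ a))
      back (inj₂ (inj₁ (u~a , _)))   = inj₁ u~a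
      back (inj₂ (inj₂ (u~b , a~b))) = inj₁ (connected-trans A′ u~b (connected-sym A′ a~b))

  ncomp-remove : ∀ A e → e ∈ᵇ A ≡ true →
    (Connected (remove A e) (end₁ e) (end₂ e) × ncomp G (remove A e) ≡ ncomp G A) ⊎
    (¬ Connected (remove A e) (end₁ e) (end₂ e) × ncomp G (remove A e) ≡ suc (ncomp G A))
  ncomp-remove A e e∈A with ≡true⊎≡false (connected G (remove A e) (end₁ e) (end₂ e))
  ... | inj₁ c = inj₁ (c , sym (ncomp-glue-connected A-e⊑A (remove-glued A e e∈A) c))
    where A-e⊑A = connected-mono (remove A e) A (remove-⊆ A e)
  ... | inj₂ c = inj₂ ((λ c′ → true≢false c′ c) ,
                      ncomp-glue-separated (connected-mono (remove A e) A (remove-⊆ A e)) (connected-edge A e e∈A)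
                                           (remove-glued A e e∈A) (λ c′ → true≢false c′ c))

  ncomp-edgeless : ∀ A → (∀ e → e ∈ᵇ A ≡ false) → ncomp G A ≡ n
  ncomp-edgeless A edgeless = trans (ncomp≡count-isRoot A) (count-all (isRoot A) (λ v → isRoot-intro A v
    (λ u u<v u~v → ℕ.<-irrefl (cong toℕ (only-itself u~v)) u<v)))
    where
    only-itself : ∀ {u v} → Connected A u v → u ≡ v
    only-itself {u} {v} = connected-ind A u (u ≡_) refl (λ f f∈A → ⊥-elim (true≢false f∈A (edgeless f))) v

  n∸a≡1+n∸1+a : ∀ {n a} → a < n → n ∸ a ≡ suc (n ∸ suc a)
  n∸a≡1+n∸1+a {suc n} {zero}  _         = refl
  n∸a≡1+n∸1+a {suc n} {suc a} (s≤s a<n) = n∸a≡1+n∸1+a a<n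

  rk≤∣∣ : ∀ A → rk G A ≤ ∣ A ∣
  rk≤∣∣ A = go ∣ A ∣ A refl
    where
    go : ∀ k A → ∣ A ∣ ≡ k → rk G A ≤ k
    go zero    A ∣A∣≡0 = ℕ.≤-reflexive (trans (cong (n ∸_) (ncomp-edgeless A edgeless)) (ℕ.n∸n≡0 n))
      where edgeless = count-zero⁻¹ (_∈ᵇ A) (trans (sym (∣∣≡count A)) ∣A∣≡0)
    go (suc k) A ∣A∣≡1+k with nonempty A ∣A∣≡1+k
    ... | e , e∈A with ncomp-remove A e e∈A | go k (remove A e) (ℕ.suc-injective (trans (sym (∣remove∣ A e e∈A)) ∣A∣≡1+k))
    ...   | inj₁ (_ , same) | rk≤k = ℕ.m≤n⇒m≤1+n (subst (λ c → n ∸ c ≤ k) same rk≤k)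
    ...   | inj₂ (_ , split) | rk≤k = begin
      n ∸ ncomp G A              ≡⟨ n∸a≡1+n∸1+a (subst (_≤ n) split (ncomp≤n (remove A e))) ⟩
      suc (n ∸ suc (ncomp G A))  ≡⟨ cong (λ c → suc (n ∸ c)) split ⟨
      suc (rk G (remove A e))    ≤⟨ s≤s rk≤k ⟩
      suc k                      ∎
      where open ℕ.≤-Reasoning

  rk-mono : ∀ A B → A ⊆ B → rk G A ≤ rk G B
  rk-mono A B A⊆B = ℕ.∸-monoʳ-≤ n (ncomp-anti (connected-mono A B A⊆B))

  corank : Subset m → ℕ
  corank A = ∣ A ∣ ∸ rk G A

  ∣∣≡rk+corank : ∀ A → ∣ A ∣ ≡ rk G A + corank A
  ∣∣≡rk+corank A = sym (ℕ.m+[n∸m]≡n (rk≤∣∣ A))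

  corank≤∣∣ : ∀ A → corank A ≤ ∣ A ∣
  corank≤∣∣ A = ℕ.m∸n≤m ∣ A ∣ (rk G A)

  data EdgeRemoval (A : Subset m) (e : Fin m) : Set where
    nonBridge : Connected (remove A e) (end₁ e) (end₂ e) →
                rk G (remove A e) ≡ rk G A → corank A ≡ suc (corank (remove A e)) → EdgeRemoval A e
    bridge    : ¬ Connected (remove A e) (end₁ e) (end₂ e) →
                rk G A ≡ suc (rk G (remove A e)) → corank A ≡ corank (remove A e) → EdgeRemoval A e

  edgeRemoval : ∀ A e → e ∈ᵇ A ≡ true → EdgeRemoval A e
  edgeRemoval A e e∈A with ncomp-remove A e e∈A
  ... | inj₁ (c , same) = nonBridge c rk≡
    (trans (cong₂ _∸_ (∣remove∣ A e e∈A) (sym rk≡)) (ℕ.+-∸-assoc 1 (rk≤∣∣ (remove A e))))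
    where rk≡ = cong (n ∸_) same
  ... | inj₂ (c , split) = bridge c rk≡ (cong₂ _∸_ (∣remove∣ A e e∈A) rk≡)
    where
    rk≡ : rk G A ≡ suc (rk G (remove A e))
    rk≡ = trans (n∸a≡1+n∸1+a (subst (_≤ n) split (ncomp≤n (remove A e)))) (cong (λ c → suc (n ∸ c)) (sym split))

  corank-mono : ∀ C A → C ⊆ A → corank C ≤ corank A
  corank-mono C A C⊆A = go ∣ A ∣ A C⊆A refl
    where
    go : ∀ k A → C ⊆ A → ∣ A ∣ ≡ k → corank C ≤ corank A
    go k A C⊆A ∣A∣≡k with Fin.any? (λ e → e ∈ᵇ A ∧ not (e ∈ᵇ C) Bool.≟ true)
    ... | no none = ℕ.≤-reflexive (cong corank (subset-ext same))
      where
      same : ∀ e → e ∈ᵇ C ≡ e ∈ᵇ A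
      same e = bool-ext (C⊆A e) (λ e∈A → Bool.not-injective (Bool.¬-not (λ e∉C → none (e , ∧-intro e∈A e∉C))))
    go zero    A C⊆A ∣A∣≡0 | yes (e , e∈A-C) =
      ⊥-elim (ℕ.0≢1+n (trans (sym ∣A∣≡0) (∣remove∣ A e (∧-elimˡ _ e∈A-C))))
    go (suc k) A C⊆A ∣A∣≡1+k | yes (e , e∈A-C) =
      ℕ.≤-trans (go k (remove A e) (⊆-remove C A e C⊆A e∉C) (ℕ.suc-injective (trans (sym (∣remove∣ A e e∈A)) ∣A∣≡1+k)))
                (removal-≤ (edgeRemoval A e e∈A))
      where
      e∈A = ∧-elimˡ (e ∈ᵇ A) e∈A-C
      e∉C = not-true (∧-elimʳ (e ∈ᵇ A) e∈A-C)
      removal-≤ : EdgeRemoval A e → corank (remove A e) ≤ corank A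
      removal-≤ (nonBridge _ _ cr≡) = ℕ.≤-trans (ℕ.n≤1+n _) (ℕ.≤-reflexive (sym cr≡))
      removal-≤ (bridge _ _ cr≡)    = ℕ.≤-reflexive (sym cr≡)

  -- Degrees and cycles

  deg₁ deg₂ : Subset m → Fin n → ℕ
  deg₁ C v = count (λ e → e ∈ᵇ C ∧ (end₁ e == v))
  deg₂ C v = count (λ e → e ∈ᵇ C ∧ (end₂ e == v))

  deg≡deg₁+deg₂ : ∀ C v → deg G C v ≡ deg₁ C v + deg₂ C v
  deg≡deg₁+deg₂ C v =
    cong₂ _+_ (countFin≡count (λ e → e ∈ᵇ C ∧ (end₁ e == v))) (countFin≡count (λ e → e ∈ᵇ C ∧ (end₂ e == v)))

  deg-remove : ∀ C e → e ∈ᵇ C ≡ true → ∀ v →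
    deg G C v ≡ deg G (remove C e) v + iverson (end₁ e == v) + iverson (end₂ e == v)
  deg-remove C e e∈C v = begin
    deg G C v
      ≡⟨ deg≡deg₁+deg₂ C v ⟩
    deg₁ C v + deg₂ C v
      ≡⟨ cong₂ _+_ (count-remove C e e∈C (λ f → end₁ f == v)) (count-remove C e e∈C (λ f → end₂ f == v)) ⟩
    (deg₁ (remove C e) v + iverson (end₁ e == v)) + (deg₂ (remove C e) v + iverson (end₂ e == v))
      ≡⟨ lemma (deg₁ (remove C e) v) (deg₂ (remove C e) v) _ _ ⟩
    deg₁ (remove C e) v + deg₂ (remove C e) v + iverson (end₁ e == v) + iverson (end₂ e == v)
      ≡⟨ cong (λ d → d + iverson (end₁ e == v) + iverson (end₂ e == v)) (deg≡deg₁+deg₂ (remove C e) v) ⟨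
    deg G (remove C e) v + iverson (end₁ e == v) + iverson (end₂ e == v) ∎
    where
    open ≡-Reasoning
    lemma : ∀ x y a b → (x + a) + (y + b) ≡ x + y + a + b
    lemma = solve-∀

  degWithin : (Fin n → Bool) → Subset m → Fin n → ℕ
  degWithin K C v = if K v then deg G C v else 0

  sum-degWithin : ∀ K C →
    ∑[ v < n ] degWithin K C v ≡ count (λ e → e ∈ᵇ C ∧ K (end₁ e)) + count (λ e → e ∈ᵇ C ∧ K (end₂ e))
  sum-degWithin K C = begin
    ∑[ v < n ] degWithin K C v
      ≡⟨ sum-cong-≗ split ⟩
    ∑[ v < n ] (count (λ e → (e ∈ᵇ C ∧ K v) ∧ (end₁ e == v)) + count (λ e → (e ∈ᵇ C ∧ K v) ∧ (end₂ e == v)))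
      ≡⟨ ∑-distrib-+ (λ v → count (λ e → (e ∈ᵇ C ∧ K v) ∧ (end₁ e == v))) (λ v → count (λ e → (e ∈ᵇ C ∧ K v) ∧ (end₂ e == v))) ⟩
    ∑[ v < n ] count (λ e → (e ∈ᵇ C ∧ K v) ∧ (end₁ e == v)) + ∑[ v < n ] count (λ e → (e ∈ᵇ C ∧ K v) ∧ (end₂ e == v))
      ≡⟨ cong₂ _+_ (sum-fibres (λ e v → e ∈ᵇ C ∧ K v) end₁) (sum-fibres (λ e v → e ∈ᵇ C ∧ K v) end₂) ⟩
    count (λ e → e ∈ᵇ C ∧ K (end₁ e)) + count (λ e → e ∈ᵇ C ∧ K (end₂ e)) ∎
    where
    open ≡-Reasoning
    guard : ∀ (f : Fin m → Fin n) v →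
      count (λ e → (e ∈ᵇ C ∧ K v) ∧ (f e == v)) ≡ (if K v then count (λ e → e ∈ᵇ C ∧ (f e == v)) else 0)
    guard f v with K v
    ... | true  = count-cong (λ e → cong (_∧ (f e == v)) (Bool.∧-identityʳ (e ∈ᵇ C)))
    ... | false = count-zero _ (λ e → cong (_∧ (f e == v)) (Bool.∧-zeroʳ (e ∈ᵇ C)))
    split : ∀ v →
      degWithin K C v ≡ count (λ e → (e ∈ᵇ C ∧ K v) ∧ (end₁ e == v)) + count (λ e → (e ∈ᵇ C ∧ K v) ∧ (end₂ e == v))
    split v rewrite guard end₁ v | guard end₂ v with K v
    ... | true  = deg≡deg₁+deg₂ C v
    ... | false = refl

  handshake : ∀ C → ∑[ v < n ] deg G C v ≡ 2 * ∣ C ∣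
  handshake C = begin
    ∑[ v < n ] deg G C v
      ≡⟨ sum-degWithin (λ _ → true) C ⟩
    count (λ e → e ∈ᵇ C ∧ true) + count (λ e → e ∈ᵇ C ∧ true)
      ≡⟨ cong (λ c → c + c) (trans (count-cong (λ e → Bool.∧-identityʳ (e ∈ᵇ C))) (sym (∣∣≡count C))) ⟩
    ∣ C ∣ + ∣ C ∣
      ≡⟨ cong (∣ C ∣ +_) (ℕ.+-identityʳ ∣ C ∣) ⟨
    2 * ∣ C ∣ ∎
    where open ≡-Reasoning

  cycle-nonempty : ∀ C → isCycle G C ≡ true → ∃ λ e → e ∈ᵇ C ≡ true
  cycle-nonempty C cycle = anyFin-elim (_∈ᵇ C) (∧-elimˡ _ cycle)

  cycle-degree : ∀ C → isCycle G C ≡ true → ∀ v → deg G C v ≡ 0 ⊎ deg G C v ≡ 2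
  cycle-degree C cycle v with ∨-elim _ (allFin-elim (λ v → ⌊ deg G C v ℕ.≟ 0 ⌋ ∨ ⌊ deg G C v ℕ.≟ 2 ⌋)
                                          (∧-elimˡ _ (∧-elimʳ (anyFin (_∈ᵇ C)) cycle)) v)
  ... | inj₁ deg≡0 = inj₁ (⌊⌋⇒ (deg G C v ℕ.≟ 0) deg≡0)
  ... | inj₂ deg≡2 = inj₂ (⌊⌋⇒ (deg G C v ℕ.≟ 2) deg≡2)

  cycle-intro : ∀ C → (∃ λ e → e ∈ᵇ C ≡ true) → (∀ v → deg G C v ≡ 0 ⊎ deg G C v ≡ 2) →
    (∀ e f → e ∈ᵇ C ≡ true → f ∈ᵇ C ≡ true → Connected C (end₁ e) (end₁ f)) → isCycle G C ≡ true
  cycle-intro C (e , e∈C) degree connected′ =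
    ∧-intro (anyFin-intro _ e e∈C) (∧-intro (allFin-intro _ degree-ok) (allFin-intro _ (λ e → allFin-intro _ (connected-ok e))))
    where
    degree-ok : ∀ v → ⌊ deg G C v ℕ.≟ 0 ⌋ ∨ ⌊ deg G C v ℕ.≟ 2 ⌋ ≡ true
    degree-ok v with degree v
    ... | inj₁ deg≡0 = ∨-introˡ (⌊⌋-true (deg G C v ℕ.≟ 0) deg≡0)
    ... | inj₂ deg≡2 = ∨-introʳ _ (⌊⌋-true (deg G C v ℕ.≟ 2) deg≡2)
    connected-ok : ∀ e f → not (e ∈ᵇ C ∧ f ∈ᵇ C) ∨ connected G C (end₁ e) (end₁ f) ≡ true
    connected-ok e f with ≡true⊎≡false (e ∈ᵇ C ∧ f ∈ᵇ C)
    ... | inj₁ both = ∨-introʳ _ (connected′ e f (∧-elimˡ _ both) (∧-elimʳ _ both))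
    ... | inj₂ notBoth = ∨-introˡ (cong not notBoth)

  degWithin-remove : ∀ K C e → e ∈ᵇ C ≡ true → ∀ v →
    degWithin K C v ≡ degWithin K (remove C e) v + iverson (K v ∧ (end₁ e == v)) + iverson (K v ∧ (end₂ e == v))
  degWithin-remove K C e e∈C v with K v
  ... | true  = deg-remove C e e∈C v
  ... | false = refl

  degWithin-cycle-even : ∀ C → isCycle G C ≡ true → ∀ K → ∃ λ t → ∑[ v < n ] degWithin K C v ≡ 2 * t
  degWithin-cycle-even C cycle K = sum-even (degWithin K C) within
    where
    within : ∀ v → degWithin K C v ≡ 0 ⊎ degWithin K C v ≡ 2
    within v with K v
    ... | true  = cycle-degree C cycle v
    ... | false = inj₁ refl

  -- Inside the component K of end₁ e in C - e, every edge of C - e has both or no ends, and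
  -- e itself contributes only at end₁ e: the degree sum of C over K is odd.
  degWithin-component-odd : ∀ C e → e ∈ᵇ C ≡ true → ¬ Connected (remove C e) (end₁ e) (end₂ e) →
    ∃ λ X → ∑[ v < n ] degWithin (connected G (remove C e) (end₁ e)) C v ≡ suc (2 * X)
  degWithin-component-odd C e e∈C a≁b = X , (begin
    ∑[ v < n ] degWithin K C v
      ≡⟨ sum-cong-≗ (degWithin-remove K C e e∈C) ⟩
    ∑[ v < n ] (degWithin K C′ v + iverson (K v ∧ (end₁ e == v)) + iverson (K v ∧ (end₂ e == v)))
      ≡⟨ ∑-distrib-+ (λ v → degWithin K C′ v + iverson (K v ∧ (end₁ e == v))) (λ v → iverson (K v ∧ (end₂ e == v))) ⟩
    ∑[ v < n ] (degWithin K C′ v + iverson (K v ∧ (end₁ e == v))) + ∑[ v < n ] iverson (K v ∧ (end₂ e == v))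
      ≡⟨ cong₂ _+_ (∑-distrib-+ (degWithin K C′) (λ v → iverson (K v ∧ (end₁ e == v)))) (sum-point K (end₂ e)) ⟩
    ∑[ v < n ] degWithin K C′ v + ∑[ v < n ] iverson (K v ∧ (end₁ e == v)) + iverson (K (end₂ e))
      ≡⟨ cong₂ (λ s b → s + b + iverson (K (end₂ e))) (sum-degWithin K C′) (sum-point K (end₁ e)) ⟩
    X + count (λ f → f ∈ᵇ C′ ∧ K (end₂ f)) + iverson (K (end₁ e)) + iverson (K (end₂ e))
      ≡⟨ cong₂ (λ c b → X + c + iverson (K (end₁ e)) + iverson b) (sym ends-together) (Bool.¬-not a≁b) ⟩
    X + X + iverson (K (end₁ e)) + 0
      ≡⟨ cong (λ b → X + X + iverson b + 0) (connected-refl C′ (end₁ e)) ⟩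
    X + X + 1 + 0
      ≡⟨ lemma X ⟩
    suc (2 * X) ∎)
    where
    open ≡-Reasoning
    C′ = remove C e
    K : Fin n → Bool
    K = connected G C′ (end₁ e)
    X = count (λ f → f ∈ᵇ C′ ∧ K (end₁ f))
    ends-together : X ≡ count (λ f → f ∈ᵇ C′ ∧ K (end₂ f))
    ends-together = count-cong same
      where
      same : ∀ f → (f ∈ᵇ C′ ∧ K (end₁ f)) ≡ (f ∈ᵇ C′ ∧ K (end₂ f))
      same f with ≡true⊎≡false (f ∈ᵇ C′)
      ... | inj₂ f∉C′ rewrite f∉C′ = refl
      ... | inj₁ f∈C′ = cong₂ _∧_ refl
        (bool-ext (λ k → connected-trans C′ k (connected-edge C′ f f∈C′))
                  (λ k → connected-trans C′ k (connected-sym C′ (connected-edge C′ f f∈C′))))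
    lemma : ∀ x → x + x + 1 + 0 ≡ suc (2 * x)
    lemma = solve-∀

  cycle-edge-nonBridge : ∀ C → isCycle G C ≡ true → ∀ e → e ∈ᵇ C ≡ true → Connected (remove C e) (end₁ e) (end₂ e)
  cycle-edge-nonBridge C cycle e e∈C with ≡true⊎≡false (connected G (remove C e) (end₁ e) (end₂ e))
  ... | inj₁ a~b = a~b
  ... | inj₂ a≁b with degWithin-cycle-even C cycle (connected G (remove C e) (end₁ e))
                    | degWithin-component-odd C e e∈C (λ a~b → true≢false a~b a≁b)
  ...   | t , even | X , odd = ⊥-elim (ℕ.even≢odd t X (trans (sym even) odd))

  cycle-corank : ∀ C → isCycle G C ≡ true → 1 ≤ corank C
  cycle-corank C cycle with cycle-nonempty C cycle
  ... | e , e∈C with edgeRemoval C e e∈C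
  ...   | nonBridge _ _ corank≡ = subst (1 ≤_) (sym corank≡) (s≤s z≤n)
  ...   | bridge a≁b _ _        = ⊥-elim (a≁b (cycle-edge-nonBridge C cycle e e∈C))

  -- Bridgeless edge sets

  isolated : Subset m → Fin n → Bool
  isolated B v = ⌊ deg G B v ℕ.≟ 0 ⌋

  isolated-connected : ∀ B {v u} → deg G B v ≡ 0 → Connected B v u → v ≡ u
  isolated-connected B {v} {u} deg≡0 = connected-ind B v (v ≡_) refl closed u
    where
    deg₁≡0 = ℕ.m+n≡0⇒m≡0 (deg₁ B v) (trans (sym (deg≡deg₁+deg₂ B v)) deg≡0)
    deg₂≡0 = ℕ.m+n≡0⇒n≡0 (deg₁ B v) (trans (sym (deg≡deg₁+deg₂ B v)) deg≡0)
    closed : ∀ f → f ∈ᵇ B ≡ true → (v ≡ end₁ f → v ≡ end₂ f) × (v ≡ end₂ f → v ≡ end₁ f)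
    closed f f∈B = (λ v≡end₁ → ⊥-elim (true≢false (∧-intro f∈B (≡⇒== (sym v≡end₁))) (count-zero⁻¹ _ deg₁≡0 f)))
                 , (λ v≡end₂ → ⊥-elim (true≢false (∧-intro f∈B (≡⇒== (sym v≡end₂))) (count-zero⁻¹ _ deg₂≡0 f)))

  end₁-not-isolated : ∀ B e → e ∈ᵇ B ≡ true → deg G B (end₁ e) ≢ 0
  end₁-not-isolated B e e∈B deg≡0 = ℕ.<-irrefl refl (ℕ.≤-trans (ℕ.≤-trans
    (count-pos _ e (∧-intro e∈B (==-refl (end₁ e)))) (ℕ.m≤m+n (deg₁ B (end₁ e)) _))
    (ℕ.≤-reflexive (trans (sym (deg≡deg₁+deg₂ B (end₁ e))) deg≡0)))

  incident-edge : ∀ B v → deg G B v ≢ 0 → ∃ λ e → e ∈ᵇ B ≡ true × (end₁ e ≡ v ⊎ end₂ e ≡ v)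
  incident-edge B v deg≢0 with Fin.any? (λ e → e ∈ᵇ B ∧ ((end₁ e == v) ∨ (end₂ e == v)) Bool.≟ true)
  ... | yes (e , incident) with ∨-elim (end₁ e == v) (∧-elimʳ (e ∈ᵇ B) incident)
  ...   | inj₁ end₁≡v = e , ∧-elimˡ _ incident , inj₁ (==⇒≡ end₁≡v)
  ...   | inj₂ end₂≡v = e , ∧-elimˡ _ incident , inj₂ (==⇒≡ end₂≡v)
  incident-edge B v deg≢0 | no none = ⊥-elim (deg≢0 (trans (deg≡deg₁+deg₂ B v)
    (cong₂ _+_ (count-zero _ (λ e → Bool.¬-not (λ p → none (e , via₁ e p))))
               (count-zero _ (λ e → Bool.¬-not (λ p → none (e , via₂ e p)))))))
    where
    via₁ : ∀ e → e ∈ᵇ B ∧ (end₁ e == v) ≡ true → e ∈ᵇ B ∧ ((end₁ e == v) ∨ (end₂ e == v)) ≡ true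
    via₁ e p = ∧-intro (∧-elimˡ (e ∈ᵇ B) p) (∨-introˡ (∧-elimʳ (e ∈ᵇ B) p))
    via₂ : ∀ e → e ∈ᵇ B ∧ (end₂ e == v) ≡ true → e ∈ᵇ B ∧ ((end₁ e == v) ∨ (end₂ e == v)) ≡ true
    via₂ e p = ∧-intro (∧-elimˡ (e ∈ᵇ B) p) (∨-introʳ (end₁ e == v) (∧-elimʳ (e ∈ᵇ B) p))

  Bridgeless : Subset m → Set
  Bridgeless B = ∀ e → e ∈ᵇ B ≡ true → rk G (remove B e) ≡ rk G B

  bridgeless-nonBridge : ∀ B → Bridgeless B → ∀ e → e ∈ᵇ B ≡ true → Connected (remove B e) (end₁ e) (end₂ e)
  bridgeless-nonBridge B bridgeless e e∈B with edgeRemoval B e e∈B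
  ... | nonBridge a~b _ _ = a~b
  ... | bridge _ rk≡ _    = ⊥-elim (ℕ.1+n≢n (sym (trans (bridgeless e e∈B) rk≡)))

  bridgeless-deg≥2 : ∀ B → Bridgeless B → ∀ v → deg G B v ≢ 0 → 2 ≤ deg G B v
  bridgeless-deg≥2 B bridgeless v deg≢0 with incident-edge B v deg≢0
  ... | e , e∈B , at-v = subst (2 ≤_) (sym (deg-remove B e e∈B v)) (two (deg G B′ v) _ _ (loop-or-not (end₁ e Fin.≟ end₂ e)))
    where
    B′ = remove B e
    a~b = bridgeless-nonBridge B bridgeless e e∈B
    ends-at-v : end₁ e ≡ v ⊎ end₂ e ≡ v → iverson (end₁ e == v) ≡ 1 ⊎ iverson (end₂ e == v) ≡ 1
    ends-at-v (inj₁ a≡v) = inj₁ (cong iverson (≡⇒== a≡v))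
    ends-at-v (inj₂ b≡v) = inj₂ (cong iverson (≡⇒== b≡v))
    loop-or-not : Dec (end₁ e ≡ end₂ e) →
      (iverson (end₁ e == v) ≡ 1 × iverson (end₂ e == v) ≡ 1) ⊎
      ((iverson (end₁ e == v) ≡ 1 ⊎ iverson (end₂ e == v) ≡ 1) × deg G B′ v ≢ 0)
    loop-or-not (yes a≡b) = inj₁ (loop at-v)
      where
      loop : end₁ e ≡ v ⊎ end₂ e ≡ v → iverson (end₁ e == v) ≡ 1 × iverson (end₂ e == v) ≡ 1
      loop (inj₁ a≡v) = cong iverson (≡⇒== a≡v) , cong iverson (≡⇒== (trans (sym a≡b) a≡v))
      loop (inj₂ b≡v) = cong iverson (≡⇒== (trans a≡b b≡v)) , cong iverson (≡⇒== b≡v)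
    loop-or-not (no a≢b) = inj₂ (ends-at-v at-v , not-isolated at-v)
      where
      not-isolated : end₁ e ≡ v ⊎ end₂ e ≡ v → deg G B′ v ≢ 0
      not-isolated (inj₁ refl) deg≡0 = a≢b (isolated-connected B′ deg≡0 a~b)
      not-isolated (inj₂ refl) deg≡0 = a≢b (sym (isolated-connected B′ deg≡0 (connected-sym B′ a~b)))
    two : ∀ d i j → (i ≡ 1 × j ≡ 1) ⊎ ((i ≡ 1 ⊎ j ≡ 1) × d ≢ 0) → 2 ≤ d + i + j
    two d i j h = ℕ.≤-trans (bound h) (ℕ.≤-reflexive (sym (ℕ.+-assoc d i j)))
      where
      bound : (i ≡ 1 × j ≡ 1) ⊎ ((i ≡ 1 ⊎ j ≡ 1) × d ≢ 0) → 2 ≤ d + (i + j)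
      bound (inj₁ (refl , refl))       = ℕ.m≤n+m 2 d
      bound (inj₂ (inj₁ refl , d≢0)) = ℕ.+-mono-≤ (ℕ.n≢0⇒n>0 d≢0) (ℕ.m≤m+n 1 j)
      bound (inj₂ (inj₂ refl , d≢0)) = ℕ.+-mono-≤ (ℕ.n≢0⇒n>0 d≢0) (ℕ.m≤n+m 1 i)

  isolated-isRoot : ∀ B v → deg G B v ≡ 0 → isRoot B v ≡ true
  isolated-isRoot B v deg≡0 =
    isRoot-intro B v (λ u u<v u~v → ℕ.<-irrefl (cong toℕ (sym (isolated-connected B deg≡0 (connected-sym B u~v)))) u<v)

  nonIsolatedRoot : Subset m → Fin n → Bool
  nonIsolatedRoot B v = isRoot B v ∧ not (isolated B v)

  nonIsolatedRoot-exists : ∀ B x → deg G B x ≢ 0 → ∃ λ r → nonIsolatedRoot B r ≡ true × Connected B r x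
  nonIsolatedRoot-exists B x deg≢0 with root-exists B x
  ... | r , r-root , r~x with ≡true⊎≡false (isolated B r)
  ...   | inj₁ r-isolated = ⊥-elim (deg≢0 (subst (λ z → deg G B z ≡ 0) (isolated-connected B deg≡0 r~x) deg≡0))
    where deg≡0 = ⌊⌋⇒ (deg G B r ℕ.≟ 0) r-isolated
  ...   | inj₂ r-not-isolated = r , ∧-intro r-root (cong not r-not-isolated) , r~x

  ncomp≡isolated+nonIsolatedRoots : ∀ B → ncomp G B ≡ count (isolated B) + count (nonIsolatedRoot B)
  ncomp≡isolated+nonIsolatedRoots B =
    trans (ncomp≡count-isRoot B) (trans (count-split (isRoot B) (isolated B)) (cong (_+ count (nonIsolatedRoot B)) (count-cong roots)))
    where
    roots : ∀ v → isRoot B v ∧ isolated B v ≡ isolated B v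
    roots v with ≡true⊎≡false (isolated B v)
    ... | inj₁ iso rewrite iso | isolated-isRoot B v (⌊⌋⇒ (deg G B v ℕ.≟ 0) iso) = refl
    ... | inj₂ iso rewrite iso = Bool.∧-zeroʳ (isRoot B v)

  nonIsolated-connected : ∀ B → count (nonIsolatedRoot B) ≤ 1 → ∀ u v → deg G B u ≢ 0 → deg G B v ≢ 0 → Connected B u v
  nonIsolated-connected B R≤1 u v u≢0 v≢0 with nonIsolatedRoot-exists B u u≢0 | nonIsolatedRoot-exists B v v≢0
  ... | ru , ru-root , ru~u | rv , rv-root , rv~v with ru Fin.≟ rv
  ...   | yes refl  = connected-trans B (connected-sym B ru~u) rv~v
  ...   | no  ru≢rv = ⊥-elim (ℕ.<-irrefl refl (ℕ.≤-trans (count-two _ ru rv ru≢rv ru-root rv-root) R≤1))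

  nonIsolated : Subset m → Fin n → Bool
  nonIsolated B v = not (isolated B v)

  rk≡nonIsolated∸nonIsolatedRoots : ∀ B → rk G B ≡ count (nonIsolated B) ∸ count (nonIsolatedRoot B)
  rk≡nonIsolated∸nonIsolatedRoots B =
    trans (cong₂ _∸_ n≡I+N (ncomp≡isolated+nonIsolatedRoots B)) (ℕ.[m+n]∸[m+o]≡n∸o (count (isolated B)) _ _)
    where
    n≡I+N : n ≡ count (isolated B) + count (nonIsolated B)
    n≡I+N = trans (sym (count-all (λ _ → true) (λ _ → refl))) (count-split (λ _ → true) (isolated B))

  nonIsolatedRoots≤nonIsolated : ∀ B → count (nonIsolatedRoot B) ≤ count (nonIsolated B)
  nonIsolatedRoots≤nonIsolated B = count-mono (nonIsolatedRoot B) (nonIsolated B) (λ v → ∧-elimʳ (isRoot B v))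

  nonIsolatedRoots≥1 : ∀ B e → e ∈ᵇ B ≡ true → 1 ≤ count (nonIsolatedRoot B)
  nonIsolatedRoots≥1 B e e∈B with nonIsolatedRoot-exists B (end₁ e) (end₁-not-isolated B e e∈B)
  ... | r , r-root , _ = count-pos (nonIsolatedRoot B) r r-root

  bridgeless-deg-lower : ∀ B → Bridgeless B → ∀ v → 2 * iverson (nonIsolated B v) ≤ deg G B v
  bridgeless-deg-lower B bridgeless v with ≡true⊎≡false (isolated B v)
  ... | inj₁ iso    = subst (λ b → 2 * iverson (not b) ≤ deg G B v) (sym iso) z≤n
  ... | inj₂ nonIso = subst (λ b → 2 * iverson (not b) ≤ deg G B v) (sym nonIso)
    (bridgeless-deg≥2 B bridgeless v (λ deg≡0 → true≢false (⌊⌋-true (deg G B v ℕ.≟ 0) deg≡0) nonIso))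

  bridgeless-deg-exact : ∀ B → Bridgeless B → ∣ B ∣ ≤ count (nonIsolated B) →
    ∀ v → deg G B v ≡ 2 * iverson (nonIsolated B v)
  bridgeless-deg-exact B bridgeless ∣B∣≤N =
    sum-tight (λ v → 2 * iverson (nonIsolated B v)) (deg G B) (bridgeless-deg-lower B bridgeless)
    (subst₂ _≤_ (sym (handshake B)) (*-distribˡ-sum 2 (iverson ∘ nonIsolated B)) (ℕ.*-monoʳ-≤ 2 ∣B∣≤N))

  -- With N non-isolated vertices and R components among them, |B| = N - R + 1 ≤ N, while every
  -- non-isolated vertex has degree at least 2; the handshake lemma forces degree 2 and R = 1.
  bridgeless-corank1-isCycle : ∀ B → Bridgeless B → corank B ≡ 1 → isCycle G B ≡ true
  bridgeless-corank1-isCycle B bridgeless corank≡1 = cycle-intro B (e , e∈B) degree joined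
    where
    N = count (nonIsolated B)
    R = count (nonIsolatedRoot B)
    ∣B∣≡N∸R+1 : ∣ B ∣ ≡ N ∸ R + 1
    ∣B∣≡N∸R+1 = trans (∣∣≡rk+corank B) (cong₂ _+_ (rk≡nonIsolated∸nonIsolatedRoots B) corank≡1)
    edge = nonempty B (trans ∣B∣≡N∸R+1 (ℕ.+-comm (N ∸ R) 1))
    e = proj₁ edge
    e∈B = proj₂ edge
    R≤N = nonIsolatedRoots≤nonIsolated B
    ∣B∣≤N : ∣ B ∣ ≤ N
    ∣B∣≤N = begin
      ∣ B ∣         ≡⟨ ∣B∣≡N∸R+1 ⟩
      (N ∸ R) + 1   ≤⟨ ℕ.+-monoʳ-≤ (N ∸ R) (nonIsolatedRoots≥1 B e e∈B) ⟩
      (N ∸ R) + R   ≡⟨ ℕ.m∸n+n≡m R≤N ⟩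
      N             ∎
      where open ℕ.≤-Reasoning
    exact = bridgeless-deg-exact B bridgeless ∣B∣≤N
    degree : ∀ v → deg G B v ≡ 0 ⊎ deg G B v ≡ 2
    degree v with ≡true⊎≡false (isolated B v)
    ... | inj₁ iso    = inj₁ (trans (exact v) (cong (λ b → 2 * iverson (not b)) iso))
    ... | inj₂ nonIso = inj₂ (trans (exact v) (cong (λ b → 2 * iverson (not b)) nonIso))
    ∣B∣≡N : ∣ B ∣ ≡ N
    ∣B∣≡N = ℕ.*-cancelˡ-≡ ∣ B ∣ N 2
      (trans (sym (handshake B)) (trans (sum-cong-≗ exact) (sym (*-distribˡ-sum 2 (iverson ∘ nonIsolated B)))))
    R≡1 : R ≡ 1
    R≡1 = sym (ℕ.+-cancelˡ-≡ (N ∸ R) 1 R (trans (sym ∣B∣≡N∸R+1) (trans ∣B∣≡N (sym (ℕ.m∸n+n≡m R≤N)))))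
    joined : ∀ f g → f ∈ᵇ B ≡ true → g ∈ᵇ B ≡ true → Connected B (end₁ f) (end₁ g)
    joined f g f∈B g∈B = nonIsolated-connected B (ℕ.≤-reflexive R≡1) (end₁ f) (end₁ g)
      (end₁-not-isolated B f f∈B) (end₁-not-isolated B g g∈B)

  -- Edge sets of corank at most one

  -- Delete bridges, which keeps the corank, and then non-bridges, each lowering it by one.
  bridgeless-subset : ∀ A t → 1 ≤ t → t ≤ corank A → ∃ λ B → B ⊆ A × Bridgeless B × corank B ≡ t
  bridgeless-subset A t 1≤t = go ∣ A ∣ A refl
    where
    shrink : ∀ {A} e → (∃ λ B → B ⊆ remove A e × Bridgeless B × corank B ≡ t) →
      ∃ λ B → B ⊆ A × Bridgeless B × corank B ≡ t
    shrink {A} e (B , B⊆A-e , bridgeless , corank≡t) =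
      B , (λ f f∈B → remove-⊆ A e f (B⊆A-e f f∈B)) , bridgeless , corank≡t
    go : ∀ k A → ∣ A ∣ ≡ k → t ≤ corank A → ∃ λ B → B ⊆ A × Bridgeless B × corank B ≡ t
    go zero A ∣A∣≡0 t≤cr = ⊥-elim (ℕ.<-irrefl refl (ℕ.≤-trans 1≤t (ℕ.≤-trans t≤cr (subst (corank A ≤_) ∣A∣≡0 (corank≤∣∣ A)))))
    go (suc k) A ∣A∣≡1+k t≤cr
      with Fin.any? (λ e → (e ∈ᵇ A Bool.≟ true) ×-dec ¬? (rk G (remove A e) ℕ.≟ rk G A))
    ... | yes (e , e∈A , e-bridge) = shrink {A} e (go k (remove A e) ∣A-e∣≡k (subst (t ≤_) corank≡ t≤cr))
      where
      ∣A-e∣≡k = ℕ.suc-injective (trans (sym (∣remove∣ A e e∈A)) ∣A∣≡1+k)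
      corank≡ : corank A ≡ corank (remove A e)
      corank≡ with edgeRemoval A e e∈A
      ... | nonBridge _ rk≡ _ = ⊥-elim (e-bridge rk≡)
      ... | bridge _ _ cr≡    = cr≡
    ... | no no-bridge with corank A ℕ.≟ t
    ...   | yes corank≡t = A , (λ e e∈A → e∈A) , bridgeless , corank≡t
      where
      bridgeless : Bridgeless A
      bridgeless e e∈A with rk G (remove A e) ℕ.≟ rk G A
      ... | yes rk≡  = rk≡
      ... | no  rk≢  = ⊥-elim (no-bridge (e , e∈A , rk≢))
    ...   | no corank≢t with nonempty A ∣A∣≡1+k
    ...     | e , e∈A with edgeRemoval A e e∈A
    ...       | bridge _ rk≡ _ = ⊥-elim (no-bridge (e , e∈A , λ rk≡′ → ℕ.1+n≢n (sym (trans rk≡′ rk≡))))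
    ...       | nonBridge _ _ cr≡ = shrink {A} e (go k (remove A e) ∣A-e∣≡k
                   (ℕ.≤-pred (subst (suc t ≤_) cr≡ (ℕ.≤∧≢⇒< t≤cr (corank≢t ∘ sym)))))
      where ∣A-e∣≡k = ℕ.suc-injective (trans (sym (∣remove∣ A e e∈A)) ∣A∣≡1+k)

  corank≤1 : ∀ h → IsH G h → ∀ A → ∣ A ∣ < h → corank A ≤ 1
  corank≤1 h (_ , minimal) A ∣A∣<h with 2 ℕ.≤? corank A
  ... | no  corank≱2 = ℕ.≤-pred (ℕ.≰⇒> corank≱2)
  ... | yes corank≥2 with bridgeless-subset A 2 (s≤s z≤n) corank≥2
  ...   | B , B⊆A , bridgeless , corank≡2 = ⊥-elim (ℕ.<-irrefl refl (ℕ.≤-trans ∣A∣<h (ℕ.≤-trans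
    (minimal B (bridgeless , trans (∣∣≡rk+corank B) (cong (rk G B +_) corank≡2))) (⊆⇒∣∣≤ B A B⊆A))))

  acyclic-no-cycle : ∀ A → corank A ≡ 0 → ∀ C → C ⊆ A → isCycle G C ≡ false
  acyclic-no-cycle A corank≡0 C C⊆A = Bool.¬-not (λ cycle →
    ℕ.<-irrefl refl (ℕ.≤-trans (cycle-corank C cycle) (subst (corank C ≤_) corank≡0 (corank-mono C A C⊆A))))

  corank1-cycle : ∀ A → corank A ≡ 1 → ∃ λ C → C ⊆ A × isCycle G C ≡ true
  corank1-cycle A corank≡1 with bridgeless-subset A 1 ℕ.≤-refl (ℕ.≤-reflexive (sym corank≡1))
  ... | B , B⊆A , bridgeless , corank≡1′ = B , B⊆A , bridgeless-corank1-isCycle B bridgeless corank≡1′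

  corank1-cycle-unique : ∀ A → corank A ≡ 1 →
    ∀ C D → isCycle G C ≡ true → isCycle G D ≡ true → C ⊆ A → D ⊆ A → C ≡ D
  corank1-cycle-unique A corank≡1 C D C-cycle D-cycle C⊆A D⊆A =
    subset-ext (λ e → bool-ext (within C D C-cycle D-cycle C⊆A D⊆A e) (within D C D-cycle C-cycle D⊆A C⊆A e))
    where
    within : ∀ C D → isCycle G C ≡ true → isCycle G D ≡ true → C ⊆ A → D ⊆ A → ∀ e → e ∈ᵇ C ≡ true → e ∈ᵇ D ≡ true
    within C D C-cycle D-cycle C⊆A D⊆A e e∈C with ≡true⊎≡false (e ∈ᵇ D)
    ... | inj₁ e∈D = e∈D
    ... | inj₂ e∉D with edgeRemoval A e (C⊆A e e∈C)
    ...   | bridge a≁b _ _ = ⊥-elim (a≁b (connected-mono (remove C e) (remove A e) (remove-mono C A C⊆A e)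
                                           (cycle-edge-nonBridge C C-cycle e e∈C)))
    ...   | nonBridge _ _ corank≡ = ⊥-elim (ℕ.<-irrefl refl (ℕ.≤-trans (cycle-corank D D-cycle)
            (subst (corank D ≤_) (ℕ.suc-injective (trans (sym corank≡) corank≡1)) (corank-mono D (remove A e) (⊆-remove D A e D⊆A e∉D)))))

open import Data.Integer using (ℤ; +_; _+_; _-_)
open import Data.Integer using (-[1+_]; -_; _*_; _^_; 0ℤ; 1ℤ; -1ℤ)
import Data.Integer as ℤ
import Data.Integer.Properties as ℤ
open import Data.Integer.Tactic.RingSolver using (solve-∀)
open import Data.Nat.Properties using (_<?_)

-- Binomial coefficients with an integer top

-- chooseNeg n k = (-(n+1) choose k); the clauses are Pascal's rule read backwards.
chooseNeg : ℕ → ℕ → ℤ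
chooseNeg n       zero    = 1ℤ
chooseNeg zero    (suc k) = - chooseNeg zero k
chooseNeg (suc n) (suc k) = chooseNeg n (suc k) - chooseNeg (suc n) k

choose : ℤ → ℤ → ℤ
choose _        -[1+ _ ] = 0ℤ
choose (+ n)    (+ k)    = + (n ℕ.C k)
choose -[1+ n ] (+ k)    = chooseNeg n k

choose-pascal : ∀ a b → choose (ℤ.suc a) b ≡ choose a b + choose a (ℤ.pred b)
choose-pascal a               -[1+ _ ]    = refl
choose-pascal (+ n)           (+ zero)    = refl
choose-pascal (+ n)           (+ suc k)   =
  cong +_ (sym (trans (ℕ.+-comm (n ℕ.C suc k) (n ℕ.C k)) (nCk+nC[k+1]≡[n+1]C[k+1] n k)))
choose-pascal -[1+ zero ]     (+ zero)    = refl
choose-pascal -[1+ zero ]     (+ suc k)   = sym (ℤ.+-inverseˡ (chooseNeg zero k))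
choose-pascal -[1+ suc n ]    (+ zero)    = refl
choose-pascal -[1+ suc n ]    (+ suc k)   = lemma (chooseNeg n (suc k)) (chooseNeg (suc n) k)
  where
  lemma : ∀ x y → x ≡ (x - y) + y
  lemma = solve-∀

choose-negative : ∀ a {b} → b ℤ.< 0ℤ → choose a b ≡ 0ℤ
choose-negative a {b = -[1+ _ ]} _           = refl
choose-negative a {b = + _}      (ℤ.+<+ ())

choose≡binomℤ : ∀ a b → b ℤ.≤ a → choose a b ≡ binomℤ a b
choose≡binomℤ (+ n)    (+ k)    _ = refl
choose≡binomℤ (+ n)    -[1+ k ] _ = refl
choose≡binomℤ -[1+ n ] -[1+ k ] _ = refl
choose≡binomℤ -[1+ n ] (+ k)    ()

binomℤ-sym : ∀ a b → binomℤ a b ≡ binomℤ a (a - b)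
binomℤ-sym -[1+ n ] b        = refl
binomℤ-sym (+ n)    -[1+ k ] = cong +_ (sym (k>n⇒nCk≡0 (ℕ.m<m+n n ℕ.z<s)))
binomℤ-sym (+ n)    (+ k)    with k ℕ.≤? n
... | yes k≤n = trans (cong +_ (nCk≡nC[n∸k] k≤n))
                      (cong (binomℤ (+ n)) (sym (trans (ℤ.m-n≡m⊖n n k) (ℤ.⊖-≥ k≤n))))
... | no  k≰n with ℕ.m≤n⇒∃[o]m+o≡n (ℕ.≰⇒> k≰n)
...   | o , refl = trans (cong +_ (k>n⇒nCk≡0 (ℕ.≰⇒> k≰n))) (cong (binomℤ (+ n)) (sym (lemma (+ n) (+ o))))
  where
  lemma : ∀ x y → x - ((1ℤ + x) + y) ≡ - (1ℤ + y)
  lemma = solve-∀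

-- Σ_{j ≤ M} (M choose j) F j, unfolded along Pascal's rule.
binomialTransform : ℕ → (ℕ → ℤ) → ℤ
binomialTransform zero    F = F 0
binomialTransform (suc M) F = binomialTransform M F + binomialTransform M (λ j → F (suc j))

binomialTransform-cong : ∀ M {F G : ℕ → ℤ} → (∀ j → F j ≡ G j) →
  binomialTransform M F ≡ binomialTransform M G
binomialTransform-cong zero    F≗G = F≗G 0
binomialTransform-cong (suc M) F≗G =
  cong₂ _+_ (binomialTransform-cong M F≗G) (binomialTransform-cong M (λ j → F≗G (suc j)))

binomialTransform-choose : ∀ M a b →
  binomialTransform M (λ j → choose a (b - + j)) ≡ choose (a + + M) b
binomialTransform-choose zero a b =
  cong₂ choose (sym (ℤ.+-identityʳ a)) (ℤ.+-identityʳ b)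
binomialTransform-choose (suc M) a b = begin
  binomialTransform M (λ j → choose a (b - + j))
    + binomialTransform M (λ j → choose a (b - + suc j))
    ≡⟨ cong₂ _+_ (binomialTransform-choose M a b)
                 (trans (binomialTransform-cong M (λ j → cong (choose a) (shift b (+ j))))
                        (binomialTransform-choose M a (ℤ.pred b))) ⟩
  choose (a + + M) b + choose (a + + M) (ℤ.pred b)
    ≡⟨ choose-pascal (a + + M) b ⟨
  choose (ℤ.suc (a + + M)) b
    ≡⟨ cong (λ x → choose x b) (suc-+ a (+ M)) ⟩
  choose (a + + suc M) b ∎
  where
  open ≡-Reasoning
  shift : ∀ b j → b - (1ℤ + j) ≡ (-1ℤ + b) - j
  shift = solve-∀
  suc-+ : ∀ a j → 1ℤ + (a + j) ≡ a + (1ℤ + j)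
  suc-+ = solve-∀

binomialTransform-choose-shifted : ∀ M a b c →
  binomialTransform M (λ j → choose a (b - + (c ℕ.+ j))) ≡ choose (a + + M) (b - + c)
binomialTransform-choose-shifted M a b c =
  trans (binomialTransform-cong M (λ j → cong (choose a) (lemma b (+ c) (+ j))))
        (binomialTransform-choose M a (b - + c))
  where
  lemma : ∀ b c j → b - (c + j) ≡ (b - c) - j
  lemma = solve-∀

-- Sums over lists and over all edge sets

∑ : {X : Set} → List X → (X → ℤ) → ℤ
∑ xs f = sumℤ (map f xs)

∑-cong : ∀ {X : Set} xs {f g : X → ℤ} → (∀ x → f x ≡ g x) → ∑ xs f ≡ ∑ xs g
∑-cong []       f≗g = refl
∑-cong (x ∷ xs) f≗g = cong₂ _+_ (f≗g x) (∑-cong xs f≗g)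

∑-zero : ∀ {X : Set} xs {f : X → ℤ} → (∀ x → f x ≡ 0ℤ) → ∑ xs f ≡ 0ℤ
∑-zero []       f≗0 = refl
∑-zero (x ∷ xs) f≗0 = trans (cong₂ _+_ (f≗0 x) (∑-zero xs f≗0)) refl

∑-++ : ∀ {X : Set} xs ys (f : X → ℤ) → ∑ (xs ++ ys) f ≡ ∑ xs f + ∑ ys f
∑-++ []       ys f = sym (ℤ.+-identityˡ (∑ ys f))
∑-++ (x ∷ xs) ys f = trans (cong (_+_ (f x)) (∑-++ xs ys f)) (sym (ℤ.+-assoc (f x) _ _))

∑-map : ∀ {X Y : Set} (g : Y → X) ys (f : X → ℤ) → ∑ (map g ys) f ≡ ∑ ys (λ y → f (g y))
∑-map g []       f = refl
∑-map g (y ∷ ys) f = cong (_+_ (f (g y))) (∑-map g ys f)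

∑-+ : ∀ {X : Set} xs (f g : X → ℤ) → ∑ xs (λ x → f x + g x) ≡ ∑ xs f + ∑ xs g
∑-+ []       f g = refl
∑-+ (x ∷ xs) f g = trans (cong (_+_ (f x + g x)) (∑-+ xs f g)) (lemma (f x) (g x) (∑ xs f) (∑ xs g))
  where
  lemma : ∀ a b c d → (a + b) + (c + d) ≡ (a + c) + (b + d)
  lemma = solve-∀

∑-sub : ∀ {X : Set} xs (f g : X → ℤ) → ∑ xs (λ x → f x - g x) ≡ ∑ xs f - ∑ xs g
∑-sub []       f g = refl
∑-sub (x ∷ xs) f g = trans (cong (_+_ (f x - g x)) (∑-sub xs f g)) (lemma (f x) (g x) (∑ xs f) (∑ xs g))
  where
  lemma : ∀ a b c d → (a - b) + (c - d) ≡ (a + c) - (b + d)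
  lemma = solve-∀

∑-swap : ∀ {X Y : Set} xs (ys : List Y) (f : X → Y → ℤ) →
  ∑ xs (λ x → ∑ ys (f x)) ≡ ∑ ys (λ y → ∑ xs (λ x → f x y))
∑-swap []       ys f = sym (∑-zero ys (λ _ → refl))
∑-swap (x ∷ xs) ys f =
  trans (cong (_+_ (∑ ys (f x))) (∑-swap xs ys f)) (sym (∑-+ ys (f x) (λ y → ∑ xs (λ x → f x y))))

∑-filter : ∀ {X : Set} {P : Pred X 0ℓ} (P? : Decidable P) xs (f : X → ℤ) →
  ∑ (filter P? xs) f ≡ ∑ xs (λ x → if does (P? x) then f x else 0ℤ)
∑-filter P? []       f = refl
∑-filter P? (x ∷ xs) f with does (P? x)
... | true  = cong (_+_ (f x)) (∑-filter P? xs f)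
... | false = trans (∑-filter P? xs f) (sym (ℤ.+-identityˡ _))

∑-allSubsets-suc : ∀ m (f : Subset (suc m) → ℤ) →
  ∑ (allSubsets (suc m)) f ≡ ∑ (allSubsets m) (λ A → f (outside ∷ A)) + ∑ (allSubsets m) (λ A → f (inside ∷ A))
∑-allSubsets-suc m f =
  trans (∑-++ (map (outside ∷_) (allSubsets m)) (map (inside ∷_) (allSubsets m)) f)
        (cong₂ _+_ (∑-map (outside ∷_) (allSubsets m) f) (∑-map (inside ∷_) (allSubsets m) f))

∑-allSubsets-size : ∀ m (F : ℕ → ℤ) → ∑ (allSubsets m) (λ A → F ∣ A ∣) ≡ binomialTransform m F
∑-allSubsets-size zero    F = ℤ.+-identityʳ (F 0)
∑-allSubsets-size (suc m) F = trans (∑-allSubsets-suc m (λ A → F ∣ A ∣))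
  (cong₂ _+_ (∑-allSubsets-size m F) (∑-allSubsets-size m (λ j → F (suc j))))

∑-allSubsets-supersets : ∀ m (C : Subset m) (F : ℕ → ℤ) →
  ∑ (allSubsets m) (λ A → if C ⊆ᵇ A then F ∣ A ∣ else 0ℤ)
    ≡ binomialTransform (m ℕ.∸ ∣ C ∣) (λ j → F (∣ C ∣ ℕ.+ j))
∑-allSubsets-supersets zero    []            F = ℤ.+-identityʳ (F 0)
∑-allSubsets-supersets (suc m) (outside ∷ C) F = begin
  ∑ (allSubsets (suc m)) (λ A → if (outside ∷ C) ⊆ᵇ A then F ∣ A ∣ else 0ℤ)
    ≡⟨ ∑-allSubsets-suc m _ ⟩
  ∑ (allSubsets m) (λ A → if C ⊆ᵇ A then F ∣ A ∣ else 0ℤ)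
    + ∑ (allSubsets m) (λ A → if C ⊆ᵇ A then F (suc ∣ A ∣) else 0ℤ)
    ≡⟨ cong₂ _+_ (∑-allSubsets-supersets m C F) (∑-allSubsets-supersets m C (λ j → F (suc j))) ⟩
  binomialTransform (m ℕ.∸ ∣ C ∣) (λ j → F (∣ C ∣ ℕ.+ j))
    + binomialTransform (m ℕ.∸ ∣ C ∣) (λ j → F (suc (∣ C ∣ ℕ.+ j)))
    ≡⟨ cong (_+_ (binomialTransform (m ℕ.∸ ∣ C ∣) (λ j → F (∣ C ∣ ℕ.+ j)))) (binomialTransform-cong (m ℕ.∸ ∣ C ∣) (λ j → cong F (sym (ℕ.+-suc ∣ C ∣ j)))) ⟩
  binomialTransform (suc (m ℕ.∸ ∣ C ∣)) (λ j → F (∣ C ∣ ℕ.+ j))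
    ≡⟨ cong (λ M → binomialTransform M (λ j → F (∣ C ∣ ℕ.+ j))) (sym (ℕ.+-∸-assoc 1 (∣p∣≤n C))) ⟩
  binomialTransform (suc m ℕ.∸ ∣ C ∣) (λ j → F (∣ C ∣ ℕ.+ j)) ∎
  where open ≡-Reasoning
∑-allSubsets-supersets (suc m) (inside ∷ C)  F =
  trans (∑-allSubsets-suc m _)
        (trans (cong₂ _+_ (∑-zero (allSubsets m) (λ _ → refl)) (∑-allSubsets-supersets m C (λ j → F (suc j))))
               (ℤ.+-identityˡ _))

∑-allSubsets-unique : ∀ m (Q : Subset m → Bool) x C₀ → Q C₀ ≡ true → (∀ C → Q C ≡ true → C ≡ C₀) →
  ∑ (allSubsets m) (λ C → if Q C then x else 0ℤ) ≡ x
∑-allSubsets-unique zero    Q x []       QC₀ unique =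
  trans (cong (λ b → (if b then x else 0ℤ) + 0ℤ) QC₀) (ℤ.+-identityʳ x)
∑-allSubsets-unique (suc m) Q x (c ∷ C₀) QC₀ unique = trans (∑-allSubsets-suc m _) (split c QC₀ unique)
  where
  rest : ∀ b → Q (b ∷ C₀) ≡ true → (∀ C → Q C ≡ true → C ≡ b ∷ C₀) →
    ∑ (allSubsets m) (λ C → if Q (b ∷ C) then x else 0ℤ) ≡ x
  rest b QC₀ unique = ∑-allSubsets-unique m (λ C → Q (b ∷ C)) x C₀ QC₀ (λ C p → Vec.∷-injectiveʳ (unique _ p))
  vanish : ∀ b → (∀ C → Q (b ∷ C) ≡ false) → ∑ (allSubsets m) (λ C → if Q (b ∷ C) then x else 0ℤ) ≡ 0ℤ
  vanish b Q≡false = ∑-zero (allSubsets m) (λ C → cong (λ q → if q then x else 0ℤ) (Q≡false C))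
  other : ∀ b c → b ≢ c → (∀ C → Q C ≡ true → C ≡ c ∷ C₀) → ∀ C → Q (b ∷ C) ≡ false
  other b c b≢c unique C with Q (b ∷ C) in eq
  ... | true  = ⊥-elim (b≢c (Vec.∷-injectiveˡ (unique _ eq)))
  ... | false = refl
  split : ∀ c → Q (c ∷ C₀) ≡ true → (∀ C → Q C ≡ true → C ≡ c ∷ C₀) →
    ∑ (allSubsets m) (λ C → if Q (outside ∷ C) then x else 0ℤ)
      + ∑ (allSubsets m) (λ C → if Q (inside ∷ C) then x else 0ℤ) ≡ x
  split false QC₀ unique = trans (cong₂ _+_ (rest outside QC₀ unique) (vanish inside (other inside outside (λ ()) unique)))
                                 (ℤ.+-identityʳ x)
  split true  QC₀ unique = trans (cong₂ _+_ (vanish outside (other outside inside (λ ()) unique)) (rest inside QC₀ unique))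
                                 (ℤ.+-identityˡ x)

∑-allSubsets-sieve : ∀ m (Cs : List (Subset m)) (F : ℕ → ℤ) →
  ∑ (allSubsets m) (λ A → F ∣ A ∣ - ∑ Cs (λ C → if C ⊆ᵇ A then F ∣ A ∣ else 0ℤ))
    ≡ binomialTransform m F - ∑ Cs (λ C → binomialTransform (m ℕ.∸ ∣ C ∣) (λ j → F (∣ C ∣ ℕ.+ j)))
∑-allSubsets-sieve m Cs F = begin
  ∑ (allSubsets m) (λ A → F ∣ A ∣ - ∑ Cs (λ C → if C ⊆ᵇ A then F ∣ A ∣ else 0ℤ))
    ≡⟨ ∑-sub (allSubsets m) _ _ ⟩
  ∑ (allSubsets m) (λ A → F ∣ A ∣) - ∑ (allSubsets m) (λ A → ∑ Cs (λ C → if C ⊆ᵇ A then F ∣ A ∣ else 0ℤ))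
    ≡⟨ cong₂ _-_ (∑-allSubsets-size m F) (∑-swap (allSubsets m) Cs _) ⟩
  binomialTransform m F - ∑ Cs (λ C → ∑ (allSubsets m) (λ A → if C ⊆ᵇ A then F ∣ A ∣ else 0ℤ))
    ≡⟨ cong (_-_ (binomialTransform m F)) (∑-cong Cs (λ C → ∑-allSubsets-supersets m C F)) ⟩
  binomialTransform m F - ∑ Cs (λ C → binomialTransform (m ℕ.∸ ∣ C ∣) (λ j → F (∣ C ∣ ℕ.+ j))) ∎
  where open ≡-Reasoning

-- Coefficients of T_G(x, 1)

sumℤ-addP : ∀ p q → sumℤ (PY.addP p q) ≡ sumℤ p + sumℤ q
sumℤ-addP []      q       = sym (ℤ.+-identityˡ (sumℤ q))
sumℤ-addP (a ∷ p) []      = sym (ℤ.+-identityʳ _)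
sumℤ-addP (a ∷ p) (b ∷ q) = trans (cong (_+_ (a + b)) (sumℤ-addP p q)) (lemma a b (sumℤ p) (sumℤ q))
  where
  lemma : ∀ a b x y → (a + b) + (x + y) ≡ (a + x) + (b + y)
  lemma = solve-∀

sumℤ-scaleP : ∀ c q → sumℤ (PY.scaleP c q) ≡ c * sumℤ q
sumℤ-scaleP c []      = sym (ℤ.*-zeroʳ c)
sumℤ-scaleP c (x ∷ q) = trans (cong (_+_ (c * x)) (sumℤ-scaleP c q)) (sym (ℤ.*-distribˡ-+ c x (sumℤ q)))

sumℤ-mulP : ∀ p q → sumℤ (PY.mulP p q) ≡ sumℤ p * sumℤ q
sumℤ-mulP []      q = refl
sumℤ-mulP (a ∷ p) q = begin
  sumℤ (PY.addP (PY.scaleP a q) (0ℤ ∷ PY.mulP p q))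
    ≡⟨ sumℤ-addP (PY.scaleP a q) (0ℤ ∷ PY.mulP p q) ⟩
  sumℤ (PY.scaleP a q) + (0ℤ + sumℤ (PY.mulP p q))
    ≡⟨ cong₂ (λ x y → x + (0ℤ + y)) (sumℤ-scaleP a q) (sumℤ-mulP p q) ⟩
  a * sumℤ q + (0ℤ + sumℤ p * sumℤ q)
    ≡⟨ lemma a (sumℤ p) (sumℤ q) ⟩
  (a + sumℤ p) * sumℤ q ∎
  where
  open ≡-Reasoning
  lemma : ∀ a x y → a * y + (0ℤ + x * y) ≡ (a + x) * y
  lemma = solve-∀

evalY1-addP : ∀ P Q → evalY1 (P2.addP P Q) ≡ PY.addP (evalY1 P) (evalY1 Q)
evalY1-addP []      Q       = refl
evalY1-addP (a ∷ P) []      = refl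
evalY1-addP (a ∷ P) (b ∷ Q) = cong₂ _∷_ (sumℤ-addP a b) (evalY1-addP P Q)

evalY1-scaleP : ∀ a Q → evalY1 (P2.scaleP a Q) ≡ PY.scaleP (sumℤ a) (evalY1 Q)
evalY1-scaleP a []      = refl
evalY1-scaleP a (x ∷ Q) = cong₂ _∷_ (sumℤ-mulP a x) (evalY1-scaleP a Q)

evalY1-mulP : ∀ P Q → evalY1 (P2.mulP P Q) ≡ PY.mulP (evalY1 P) (evalY1 Q)
evalY1-mulP []      Q = refl
evalY1-mulP (a ∷ P) Q = trans (evalY1-addP (P2.scaleP a Q) ([] ∷ P2.mulP P Q))
  (cong₂ PY.addP (evalY1-scaleP a Q) (cong (0ℤ ∷_) (evalY1-mulP P Q)))

evalY1-powP : ∀ P k → evalY1 (P2.powP P one2 k) ≡ PY.powP (evalY1 P) (1ℤ ∷ []) k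
evalY1-powP P zero    = refl
evalY1-powP P (suc k) = trans (evalY1-mulP P (P2.powP P one2 k)) (cong (PY.mulP (evalY1 P)) (evalY1-powP P k))

powP-constant : ∀ c k → PY.powP (c ∷ []) (1ℤ ∷ []) k ≡ (c ^ k) ∷ []
powP-constant c zero    = refl
powP-constant c (suc k) = trans (cong (PY.mulP (c ∷ [])) (powP-constant c k)) (cong (_∷ []) (ℤ.+-identityʳ (c * c ^ k)))

coeff-[] : ∀ i → coeff [] i ≡ 0ℤ
coeff-[] (+ zero)  = refl
coeff-[] (+ suc i) = refl
coeff-[] -[1+ i ]  = refl

coeff-addP : ∀ p q i → coeff (PY.addP p q) i ≡ coeff p i + coeff q i
coeff-addP p       q       -[1+ _ ]  = refl
coeff-addP []      q       i         = trans (sym (ℤ.+-identityˡ (coeff q i))) (cong (λ z → z + coeff q i) (sym (coeff-[] i)))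
coeff-addP (a ∷ p) []      i         = trans (sym (ℤ.+-identityʳ _)) (cong (_+_ (coeff (a ∷ p) i)) (sym (coeff-[] i)))
coeff-addP (a ∷ p) (b ∷ q) (+ zero)  = refl
coeff-addP (a ∷ p) (b ∷ q) (+ suc i) = coeff-addP p q (+ i)

coeff-scaleP : ∀ c p i → coeff (PY.scaleP c p) i ≡ c * coeff p i
coeff-scaleP c p       -[1+ _ ]  = sym (ℤ.*-zeroʳ c)
coeff-scaleP c []      i         = trans (coeff-[] i) (sym (trans (cong (c *_) (coeff-[] i)) (ℤ.*-zeroʳ c)))
coeff-scaleP c (x ∷ p) (+ zero)  = refl
coeff-scaleP c (x ∷ p) (+ suc i) = coeff-scaleP c p (+ i)

coeff-mulP-constant : ∀ p c i → coeff (PY.mulP p (c ∷ [])) i ≡ coeff p i * c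
coeff-mulP-constant p       c -[1+ _ ]  = refl
coeff-mulP-constant []      c i         = trans (coeff-[] i) (sym (cong (_* c) (coeff-[] i)))
coeff-mulP-constant (x ∷ p) c (+ zero)  = ℤ.+-identityʳ (x * c)
coeff-mulP-constant (x ∷ p) c (+ suc i) = coeff-mulP-constant p c (+ i)

coeff-shift : ∀ p i → coeff (0ℤ ∷ p) i ≡ coeff p (ℤ.pred i)
coeff-shift p (+ zero)  = refl
coeff-shift p (+ suc i) = refl
coeff-shift p -[1+ _ ]  = refl

coeff-mulP-xMinus1 : ∀ p i → coeff (PY.mulP (evalY1 xMinus1) p) i ≡ coeff p (ℤ.pred i) - coeff p i
coeff-mulP-xMinus1 p i = begin
  coeff (PY.addP (PY.scaleP -1ℤ p) (0ℤ ∷ PY.addP (PY.scaleP 1ℤ p) (0ℤ ∷ []))) i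
    ≡⟨ coeff-addP (PY.scaleP -1ℤ p) _ i ⟩
  coeff (PY.scaleP -1ℤ p) i + coeff (0ℤ ∷ PY.addP (PY.scaleP 1ℤ p) (0ℤ ∷ [])) i
    ≡⟨ cong₂ _+_ (coeff-scaleP -1ℤ p i) (coeff-shift _ i) ⟩
  -1ℤ * coeff p i + coeff (PY.addP (PY.scaleP 1ℤ p) (0ℤ ∷ [])) (ℤ.pred i)
    ≡⟨ cong (_+_ (-1ℤ * coeff p i)) (coeff-addP (PY.scaleP 1ℤ p) (0ℤ ∷ []) (ℤ.pred i)) ⟩
  -1ℤ * coeff p i + (coeff (PY.scaleP 1ℤ p) (ℤ.pred i) + coeff (0ℤ ∷ []) (ℤ.pred i))
    ≡⟨ cong₂ (λ x y → -1ℤ * coeff p i + (x + y)) (coeff-scaleP 1ℤ p (ℤ.pred i))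
             (trans (coeff-shift [] (ℤ.pred i)) (coeff-[] (ℤ.pred (ℤ.pred i)))) ⟩
  -1ℤ * coeff p i + (1ℤ * coeff p (ℤ.pred i) + 0ℤ)
    ≡⟨ lemma (coeff p i) (coeff p (ℤ.pred i)) ⟩
  coeff p (ℤ.pred i) - coeff p i ∎
  where
  open ≡-Reasoning
  lemma : ∀ x y → -1ℤ * x + (1ℤ * y + 0ℤ) ≡ y - x
  lemma = solve-∀

coeff-powP-xMinus1 : ∀ a i → coeff (PY.powP (evalY1 xMinus1) (1ℤ ∷ []) a) i ≡ choose (- i - 1ℤ) (+ a - i)
coeff-powP-xMinus1 zero    (+ zero)  = refl
coeff-powP-xMinus1 zero    (+ suc i) = coeff-[] (+ i)
coeff-powP-xMinus1 zero    -[1+ p ]  = cong +_ (sym (k>n⇒nCk≡0 (ℕ.n<1+n p)))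
coeff-powP-xMinus1 (suc a) i = begin
  coeff (PY.mulP (evalY1 xMinus1) P) i
    ≡⟨ coeff-mulP-xMinus1 P i ⟩
  coeff P (ℤ.pred i) - coeff P i
    ≡⟨ cong₂ _-_ (coeff-powP-xMinus1 a (ℤ.pred i)) (coeff-powP-xMinus1 a i) ⟩
  choose (- ℤ.pred i - 1ℤ) (+ a - ℤ.pred i) - choose (- i - 1ℤ) (+ a - i)
    ≡⟨ cong₂ (λ x y → choose x y - choose (- i - 1ℤ) (+ a - i)) (top i) (bottom (+ a) i) ⟩
  choose (ℤ.suc (- i - 1ℤ)) (+ suc a - i) - choose (- i - 1ℤ) (+ a - i)
    ≡⟨ cong (_- choose (- i - 1ℤ) (+ a - i)) (choose-pascal (- i - 1ℤ) (+ suc a - i)) ⟩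
  choose (- i - 1ℤ) (+ suc a - i) + choose (- i - 1ℤ) (ℤ.pred (+ suc a - i)) - choose (- i - 1ℤ) (+ a - i)
    ≡⟨ cong (λ y → choose (- i - 1ℤ) (+ suc a - i) + choose (- i - 1ℤ) y - choose (- i - 1ℤ) (+ a - i)) (pred-bottom (+ a) i) ⟩
  choose (- i - 1ℤ) (+ suc a - i) + choose (- i - 1ℤ) (+ a - i) - choose (- i - 1ℤ) (+ a - i)
    ≡⟨ cancel _ _ ⟩
  choose (- i - 1ℤ) (+ suc a - i) ∎
  where
  open ≡-Reasoning
  P = PY.powP (evalY1 xMinus1) (1ℤ ∷ []) a
  top : ∀ i → - (-1ℤ + i) - 1ℤ ≡ 1ℤ + (- i - 1ℤ)
  top = solve-∀
  bottom : ∀ a i → a - (-1ℤ + i) ≡ (1ℤ + a) - i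
  bottom = solve-∀
  pred-bottom : ∀ a i → -1ℤ + ((1ℤ + a) - i) ≡ a - i
  pred-bottom = solve-∀
  cancel : ∀ x y → x + y - y ≡ x
  cancel = solve-∀

coeff-evalY1-sum : ∀ {X : Set} (f : X → Poly2) xs i →
  coeff (evalY1 (foldr P2.addP [] (map f xs))) i ≡ ∑ xs (λ x → coeff (evalY1 (f x)) i)
coeff-evalY1-sum f []       i = coeff-[] i
coeff-evalY1-sum f (x ∷ xs) i = begin
  coeff (evalY1 (P2.addP (f x) (foldr P2.addP [] (map f xs)))) i
    ≡⟨ cong (λ p → coeff p i) (evalY1-addP (f x) _) ⟩
  coeff (PY.addP (evalY1 (f x)) (evalY1 (foldr P2.addP [] (map f xs)))) i
    ≡⟨ coeff-addP (evalY1 (f x)) _ i ⟩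
  coeff (evalY1 (f x)) i + coeff (evalY1 (foldr P2.addP [] (map f xs))) i
    ≡⟨ cong (_+_ (coeff (evalY1 (f x)) i)) (coeff-evalY1-sum f xs i) ⟩
  coeff (evalY1 (f x)) i + ∑ xs (λ x → coeff (evalY1 (f x)) i) ∎
  where open ≡-Reasoning

coeff-tutteTerm : ∀ a b i →
  coeff (evalY1 (P2.mulP (P2.powP xMinus1 one2 a) (P2.powP yMinus1 one2 b))) i ≡ choose (- i - 1ℤ) (+ a - i) * 0ℤ ^ b
coeff-tutteTerm a b i = begin
  coeff (evalY1 (P2.mulP (P2.powP xMinus1 one2 a) (P2.powP yMinus1 one2 b))) i
    ≡⟨ cong (λ p → coeff p i) (evalY1-mulP (P2.powP xMinus1 one2 a) (P2.powP yMinus1 one2 b)) ⟩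
  coeff (PY.mulP (evalY1 (P2.powP xMinus1 one2 a)) (evalY1 (P2.powP yMinus1 one2 b))) i
    ≡⟨ cong₂ (λ p q → coeff (PY.mulP p q) i) (evalY1-powP xMinus1 a) (trans (evalY1-powP yMinus1 b) (powP-constant 0ℤ b)) ⟩
  coeff (PY.mulP (PY.powP (evalY1 xMinus1) (1ℤ ∷ []) a) (0ℤ ^ b ∷ [])) i
    ≡⟨ coeff-mulP-constant _ (0ℤ ^ b) i ⟩
  coeff (PY.powP (evalY1 xMinus1) (1ℤ ∷ []) a) i * 0ℤ ^ b
    ≡⟨ cong (_* 0ℤ ^ b) (coeff-powP-xMinus1 a i) ⟩
  choose (- i - 1ℤ) (+ a - i) * 0ℤ ^ b ∎
  where open ≡-Reasoning

module TutteCoefficient {n m : ℕ} (G : Graph n m) (h : ℕ) (isH : IsH G h) where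

  open GraphTheory G
  open import Data.Nat using (_≤_; _<_; _∸_)

  r : ℕ
  r = n ∸ kG G

  cycs : List (Subset m)
  cycs = filter (λ C → ∣ C ∣ <? h) (cycles G)

  +n-kG≡+r : + n - + kG G ≡ + r
  +n-kG≡+r = trans (ℤ.m-n≡m⊖n n (kG G)) (ℤ.⊖-≥ (ncomp≤n fullSet))

  r<m : r < m
  r<m with proj₁ isH
  ... | B , (_ , ∣B∣≡rk+2) , _ = ℕ.m∸n≢0⇒n<m (λ m∸r≡0 → ℕ.n≮0 (subst (2 ≤_) m∸r≡0 2≤m∸r))
    where
    corank≡2 : corank B ≡ 2
    corank≡2 = trans (cong (_∸ rk G B) ∣B∣≡rk+2) (ℕ.m+n∸m≡n (rk G B) 2)
    2≤m∸r : 2 ≤ m ∸ r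
    2≤m∸r = subst (2 ≤_) (cong (_∸ r) (∣⊤∣≡n m)) (subst (_≤ corank fullSet) corank≡2 (corank-mono B fullSet (⊆-fullSet B)))

  +m-1+r : + (m ∸ suc r) ≡ + m - (1ℤ + + r)
  +m-1+r = sym (trans (ℤ.m-n≡m⊖n m (suc r)) (ℤ.⊖-≥ r<m))

  smallCycleIn : Subset m → Subset m → Bool
  smallCycleIn A C = isCycle G C ∧ (does (∣ C ∣ <? h) ∧ (C ⊆ᵇ A))

  ∑-small-cycles : ∀ A x →
    ∑ cycs (λ C → if C ⊆ᵇ A then x else 0ℤ) ≡ ∑ (allSubsets m) (λ C → if smallCycleIn A C then x else 0ℤ)
  ∑-small-cycles A x =
    trans (∑-filter (λ C → ∣ C ∣ <? h) (cycles G) _)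
          (trans (∑-filter (λ C → Dec.T? (isCycle G C)) (allSubsets m) _) (∑-cong (allSubsets m) nested))
    where
    nested : ∀ C → (if isCycle G C then (if does (∣ C ∣ <? h) then (if C ⊆ᵇ A then x else 0ℤ) else 0ℤ) else 0ℤ)
                   ≡ (if smallCycleIn A C then x else 0ℤ)
    nested C with isCycle G C | does (∣ C ∣ <? h)
    ... | true  | true  = refl
    ... | true  | false = refl
    ... | false | _     = refl

  -- [x^i] (x-1)^(r-j), by coeff-powP-xMinus1.
  weight : ℤ → ℕ → ℤ
  weight i j = choose (- i - 1ℤ) (+ r - i - + j)

  weight-large : ∀ {i} → + r - + h ℤ.< i → ∀ {j} → h ≤ j → weight i j ≡ 0ℤ
  weight-large {i} r-h<i {j} h≤j = choose-negative (- i - 1ℤ) (begin-strict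
    + r - i - + j      ≡⟨ lemma (+ r) i (+ j) ⟩
    (+ r - + j) - i    ≤⟨ ℤ.+-monoˡ-≤ (- i) (ℤ.+-monoʳ-≤ (+ r) (ℤ.neg-mono-≤ (ℤ.+≤+ h≤j))) ⟩
    (+ r - + h) - i    <⟨ ℤ.+-monoˡ-< (- i) r-h<i ⟩
    i - i              ≡⟨ ℤ.+-inverseʳ i ⟩
    0ℤ                 ∎)
    where
    open ℤ.≤-Reasoning
    lemma : ∀ r i j → r - i - j ≡ (r - j) - i
    lemma = solve-∀

  coeff-tutteX1 : ∀ i →
    coeff (tutteX1 G) i ≡ ∑ (allSubsets m) (λ A → choose (- i - 1ℤ) (+ (r ∸ rk G A) - i) * 0ℤ ^ corank A)
  coeff-tutteX1 i = trans (coeff-evalY1-sum _ (allSubsets m) i)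
                          (∑-cong (allSubsets m) (λ A → coeff-tutteTerm (r ∸ rk G A) (corank A) i))

  sieved : ℤ → Subset m → ℤ
  sieved i A = weight i ∣ A ∣ - ∑ cycs (λ C → if C ⊆ᵇ A then weight i ∣ A ∣ else 0ℤ)

  sieved-acyclic : ∀ i A → corank A ≡ 0 → sieved i A ≡ weight i ∣ A ∣
  sieved-acyclic i A corank≡0 = trans (cong (_-_ (weight i ∣ A ∣)) no-cycle) (ℤ.+-identityʳ (weight i ∣ A ∣))
    where
    acyclic : ∀ C → smallCycleIn A C ≡ false
    acyclic C = Bool.¬-not (λ small → true≢false (∧-elimˡ (isCycle G C) small)
      (acyclic-no-cycle A corank≡0 C (⊆ᵇ⇒⊆ C A (∧-elimʳ (does (∣ C ∣ <? h)) (∧-elimʳ (isCycle G C) small)))))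
    no-cycle : ∑ cycs (λ C → if C ⊆ᵇ A then weight i ∣ A ∣ else 0ℤ) ≡ 0ℤ
    no-cycle = trans (∑-small-cycles A (weight i ∣ A ∣))
                     (∑-zero (allSubsets m) (λ C → cong (λ b → if b then weight i ∣ A ∣ else 0ℤ) (acyclic C)))

  sieved-large : ∀ {i} → + r - + h ℤ.< i → ∀ A → h ≤ ∣ A ∣ → sieved i A ≡ 0ℤ
  sieved-large {i} r-h<i A h≤∣A∣ =
    trans (cong (λ x → x - ∑ cycs (λ C → if C ⊆ᵇ A then x else 0ℤ)) (weight-large r-h<i h≤∣A∣))
          (cong (_-_ 0ℤ) (∑-zero cycs (λ C → if-same (C ⊆ᵇ A))))
    where
    if-same : ∀ b → (if b then 0ℤ else 0ℤ) ≡ 0ℤ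
    if-same true  = refl
    if-same false = refl

  sieved-unicyclic : ∀ i A → corank A ≡ 1 → ∣ A ∣ < h → sieved i A ≡ 0ℤ
  sieved-unicyclic i A corank≡1 small = the-cycle (corank1-cycle A corank≡1)
    where
    w = weight i ∣ A ∣
    the-cycle : (∃ λ C₀ → C₀ ⊆ A × isCycle G C₀ ≡ true) → sieved i A ≡ 0ℤ
    the-cycle (C₀ , C₀⊆A , C₀-cycle) = trans (cong (_-_ w) (trans (∑-small-cycles A w)
      (∑-allSubsets-unique m (smallCycleIn A) w C₀ small-C₀ unique))) (ℤ.+-inverseʳ w)
      where
      small-C₀ : smallCycleIn A C₀ ≡ true
      small-C₀ = ∧-intro C₀-cycle (∧-intro (dec-true (∣ C₀ ∣ <? h) (ℕ.≤-<-trans (⊆⇒∣∣≤ C₀ A C₀⊆A) small))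
                                          (⊆⇒⊆ᵇ C₀ A C₀⊆A))
      unique : ∀ C → smallCycleIn A C ≡ true → C ≡ C₀
      unique C small-C = corank1-cycle-unique A corank≡1 C C₀ (∧-elimˡ (isCycle G C) small-C) C₀-cycle
        (⊆ᵇ⇒⊆ C A (∧-elimʳ (does (∣ C ∣ <? h)) (∧-elimʳ (isCycle G C) small-C))) C₀⊆A

  acyclic-exponent : ∀ i A → corank A ≡ 0 → + (r ∸ rk G A) - i ≡ + r - i - + ∣ A ∣
  acyclic-exponent i A corank≡0 = begin
    + (r ∸ rk G A) - i    ≡⟨ cong (λ k → + (r ∸ k) - i) rk≡∣A∣ ⟩
    + (r ∸ ∣ A ∣) - i     ≡⟨ cong (_- i) (trans (ℤ.m-n≡m⊖n r ∣ A ∣) (ℤ.⊖-≥ ∣A∣≤r)) ⟨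
    + r - + ∣ A ∣ - i     ≡⟨ lemma (+ r) (+ ∣ A ∣) i ⟩
    + r - i - + ∣ A ∣     ∎
    where
    open ≡-Reasoning
    rk≡∣A∣ : rk G A ≡ ∣ A ∣
    rk≡∣A∣ = sym (trans (∣∣≡rk+corank A) (trans (cong (rk G A ℕ.+_) corank≡0) (ℕ.+-identityʳ _)))
    ∣A∣≤r : ∣ A ∣ ≤ r
    ∣A∣≤r = subst (_≤ r) rk≡∣A∣ (rk-mono A fullSet (⊆-fullSet A))
    lemma : ∀ r a i → r - a - i ≡ r - i - a
    lemma = solve-∀

  term≡sieved : ∀ {i} → + r - + h ℤ.< i → ∀ A → choose (- i - 1ℤ) (+ (r ∸ rk G A) - i) * 0ℤ ^ corank A ≡ sieved i A
  term≡sieved {i} r-h<i A with corank A in corank≡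
  ... | zero  = trans (ℤ.*-identityʳ _)
                      (trans (cong (choose (- i - 1ℤ)) (acyclic-exponent i A corank≡)) (sym (sieved-acyclic i A corank≡)))
  ... | suc c = trans (ℤ.*-zeroʳ (choose (- i - 1ℤ) (+ (r ∸ rk G A) - i))) (sym (by-size (∣ A ∣ <? h)))
    where
    by-size : Dec (∣ A ∣ < h) → sieved i A ≡ 0ℤ
    by-size (no  large) = sieved-large r-h<i A (ℕ.≮⇒≥ large)
    by-size (yes small) = sieved-unicyclic i A corank≡1 small
      where
      corank≡1 = trans corank≡ (cong suc (ℕ.n≤0⇒n≡0 (ℕ.≤-pred (subst (_≤ 1) corank≡ (corank≤1 h isH A small)))))

  main-term : ∀ i → binomialTransform m (weight i) ≡ binomℤ (+ m - i - + 1) (+ n - + kG G - i)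
  main-term i = begin
    binomialTransform m (weight i)
      ≡⟨ binomialTransform-choose-shifted m (- i - 1ℤ) (+ r - i) 0 ⟩
    choose (- i - 1ℤ + + m) (+ r - i - + 0)
      ≡⟨ cong₂ choose (top (+ m) i) (ℤ.+-identityʳ (+ r - i)) ⟩
    choose (+ m - i - 1ℤ) (+ r - i)
      ≡⟨ choose≡binomℤ _ _ (subst (+ r - i ℤ.≤_) gap (ℤ.i≤i+j (+ r - i) (+ (m ∸ suc r)))) ⟩
    binomℤ (+ m - i - 1ℤ) (+ r - i)
      ≡⟨ cong (λ x → binomℤ (+ m - i - 1ℤ) (x - i)) +n-kG≡+r ⟨
    binomℤ (+ m - i - + 1) (+ n - + kG G - i) ∎
    where
    open ≡-Reasoning
    top : ∀ m i → - i - 1ℤ + m ≡ m - i - 1ℤ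
    top = solve-∀
    gap : + r - i + + (m ∸ suc r) ≡ + m - i - 1ℤ
    gap = trans (cong (_+_ (+ r - i)) +m-1+r) (lemma (+ r) (+ m) i)
      where
      lemma : ∀ r m i → r - i + (m - (1ℤ + r)) ≡ m - i - 1ℤ
      lemma = solve-∀

  cycle-term : ∀ i C → binomialTransform (m ∸ ∣ C ∣) (λ j → weight i (∣ C ∣ ℕ.+ j))
                         ≡ binomℤ (+ m - + ∣ C ∣ - i - + 1) (+ m - + n + + kG G - + 1)
  cycle-term i C = begin
    binomialTransform (m ∸ c) (λ j → weight i (c ℕ.+ j))
      ≡⟨ binomialTransform-choose-shifted (m ∸ c) (- i - 1ℤ) (+ r - i) c ⟩
    choose (- i - 1ℤ + + (m ∸ c)) (+ r - i - + c)
      ≡⟨ cong (λ x → choose x (+ r - i - + c)) (trans (cong (_+_ (- i - 1ℤ)) +m∸c) (top (+ m) (+ c) i)) ⟩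
    choose a b
      ≡⟨ choose≡binomℤ a b (subst (b ℤ.≤_) gap (ℤ.i≤i+j b (+ (m ∸ suc r)))) ⟩
    binomℤ a b
      ≡⟨ binomℤ-sym a b ⟩
    binomℤ a (a - b)
      ≡⟨ cong (binomℤ a) (trans (difference (+ m) (+ c) (+ r) i) (cong (λ x → + m - x - 1ℤ) (sym +n-kG≡+r))) ⟩
    binomℤ a (+ m - (+ n - + kG G) - 1ℤ)
      ≡⟨ cong (binomℤ a) (regroup (+ m) (+ n) (+ kG G)) ⟩
    binomℤ (+ m - + c - i - + 1) (+ m - + n + + kG G - + 1) ∎
    where
    open ≡-Reasoning
    c = ∣ C ∣
    a = + m - + c - i - 1ℤ
    b = + r - i - + c
    +m∸c : + (m ∸ c) ≡ + m - + c
    +m∸c = sym (trans (ℤ.m-n≡m⊖n m c) (ℤ.⊖-≥ (∣p∣≤n C)))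
    top : ∀ m c i → - i - 1ℤ + (m - c) ≡ m - c - i - 1ℤ
    top = solve-∀
    gap : b + + (m ∸ suc r) ≡ a
    gap = trans (cong (_+_ b) +m-1+r) (lemma (+ r) (+ m) (+ c) i)
      where
      lemma : ∀ r m c i → r - i - c + (m - (1ℤ + r)) ≡ m - c - i - 1ℤ
      lemma = solve-∀
    difference : ∀ m c r i → (m - c - i - 1ℤ) - (r - i - c) ≡ m - r - 1ℤ
    difference = solve-∀
    regroup : ∀ m n k → m - (n - k) - 1ℤ ≡ m - n + k - 1ℤ
    regroup = solve-∀

open import Data.Integer using (_<_)

corollary3p7 : ∀ {n m : ℕ} (G : Graph n m) (h : ℕ) → IsH G h →
    (i : ℤ) → (+ n - + kG G) - + h < i →
    coeff (tutteX1 G) i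
      ≡ binomℤ (+ m - i - + 1) (+ n - + kG G - i)
        - sumℤ (map (λ C → binomℤ (+ m - + ∣ C ∣ - i - + 1) (+ m - + n + + kG G - + 1))
                    (filter (λ C → ∣ C ∣ <? h) (cycles G)))
corollary3p7 {n} {m} G h isH i lt = begin
  coeff (tutteX1 G) i
    ≡⟨ coeff-tutteX1 i ⟩
  ∑ (allSubsets m) (λ A → choose (- i - 1ℤ) (+ (r ℕ.∸ rk G A) - i) * 0ℤ ^ corank A)
    ≡⟨ ∑-cong (allSubsets m) (term≡sieved r-h<i) ⟩
  ∑ (allSubsets m) (sieved i)
    ≡⟨ ∑-allSubsets-sieve m cycs (weight i) ⟩
  binomialTransform m (weight i) - ∑ cycs (λ C → binomialTransform (m ℕ.∸ ∣ C ∣) (λ j → weight i (∣ C ∣ ℕ.+ j)))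
    ≡⟨ cong₂ _-_ (main-term i) (∑-cong cycs (cycle-term i)) ⟩
  binomℤ (+ m - i - + 1) (+ n - + kG G - i)
    - ∑ cycs (λ C → binomℤ (+ m - + ∣ C ∣ - i - + 1) (+ m - + n + + kG G - + 1)) ∎
  where
  open ≡-Reasoning
  open TutteCoefficient G h isH
  open GraphTheory G using (corank)
  r-h<i : + r - + h ℤ.< i
  r-h<i = subst (λ x → x - + h ℤ.< i) +n-kG≡+r lt
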